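{- Let $b^\circ_{n,k}(1342)$ be the number of cyclic permutations $\pi\in\mathfrak S_n$ with $\pi_1=n$ whose one-line notation avoids $\delta_k=k(k-1)\cdots21$ and such that every cyclic rotation of the cycle form $C(\pi)$ avoids $1342$. Then $b^\circ_{n,3}(1342)=1$ for $n\ge1$; for $n\ge4$ and $k\ge4$, \[b^\circ_{n,k}(1342)=b^\circ_{n-1,k}(1342)+b^\circ_{n-1,k-1}(1342);\] and for $k\ge 3$ the generating function $B_k(z;1342)=\sum_{n\ge1}b^\circ_{n,k}(1342)z^n$ is \[B_k(z;1342)=\frac{z(1-z-z^2)}{1-2z}-\frac{z^{k+1}}{(1-2z)(1-z)^{k-2}}.\]
   Context: A permutation $\pi\in\mathfrak S_n$ is cyclic if it is a single $n$-cycle. Its cycle form is $C(\pi)=(1,c_2,\dots,c_n)$ with $c_2=\pi(1)$, $c_{i+1}=\pi(c_i)$. The cyclic rotations of $C(\pi)$ are the sequences $c_i,\dots,c_n,c_1,\dots,c_{i-1}$ (with $c_1=1$). A sequence avoids $\sigma\in\mathfrak S_m$ if no length-$m$ subsequence is order-isomorphic to $\sigma$. One-line notation: $\pi_1\cdots\pi_n$ with $\pi_i=\pi(i)$. -}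

module Defs where

open import Data.Bool using (Bool; true; false; _∧_; _∨_; not; if_then_else_)
open import Data.Nat using (ℕ; zero; suc; _∸_; _<ᵇ_; _≡ᵇ_)
open import Data.List using (List; []; _∷_; map; _++_; length; upTo; downFrom; concatMap; drop; take; foldr)
open import Data.Integer using (ℤ; +_; _-_; _*_; _+_)
import Data.Integer as ℤ

-- Words / permutations.  A permutation π ∈ 𝔖ₙ is represented by its
-- one-line notation π₁ ⋯ πₙ as a list of naturals with values in 1..n.

elemᵇ : ℕ → List ℕ → Bool
elemᵇ x []       = false
elemᵇ x (y ∷ ys) = (x ≡ᵇ y) ∨ elemᵇ x ys

distinctᵇ : List ℕ → Bool
distinctᵇ []       = true
distinctᵇ (x ∷ xs) = not (elemᵇ x xs) ∧ distinctᵇ xs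

words : ℕ → ℕ → List (List ℕ)
words zero    n = [] ∷ []
words (suc m) n = concatMap (λ x → map (x ∷_) (words m n)) (map suc (upTo n))

filterᵇ : {A : Set} → (A → Bool) → List A → List A
filterᵇ p []       = []
filterᵇ p (x ∷ xs) = if p x then x ∷ filterᵇ p xs else filterᵇ p xs

perms : ℕ → List (List ℕ)
perms n = filterᵇ distinctᵇ (words n n)

-- π(i) for 1 ≤ i ≤ n (one-line notation; 0 outside the range)
app : List ℕ → ℕ → ℕ
app []       _             = 0
app (x ∷ xs) zero          = 0
app (x ∷ xs) (suc zero)    = x
app (x ∷ xs) (suc (suc i)) = app xs (suc i)

orbit : List ℕ → ℕ → ℕ → List ℕ
orbit π zero    c = []
orbit π (suc m) c = c ∷ orbit π m (app π c)

cycleForm : List ℕ → List ℕ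
cycleForm π = orbit π (length π) 1

-- π is cyclic (a single n-cycle): the orbit 1, π(1), …, π^{n-1}(1)
-- consists of n distinct elements, i.e. the cycle of 1 has length n.
isCyclicᵇ : List ℕ → Bool
isCyclicᵇ π = distinctᵇ (cycleForm π)

rotations : List ℕ → List (List ℕ)
rotations w = map (λ i → drop i w ++ take i w) (upTo (length w))

subseqs : ℕ → List ℕ → List (List ℕ)
subseqs zero    _        = [] ∷ []
subseqs (suc m) []       = []
subseqs (suc m) (x ∷ xs) = map (x ∷_) (subseqs m xs) ++ subseqs (suc m) xs

_==ᵇ_ : Bool → Bool → Bool
true  ==ᵇ b = b
false ==ᵇ b = not b

headCompat : ℕ → List ℕ → ℕ → List ℕ → Bool
headCompat x (y ∷ ys) s (t ∷ ts) =
  ((x <ᵇ y) ==ᵇ (s <ᵇ t)) ∧ ((y <ᵇ x) ==ᵇ (t <ᵇ s)) ∧ headCompat x ys s ts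
headCompat x []       s []       = true
headCompat _ _        _ _        = false

-- order-isomorphism of two sequences: same length, and for all i < j,
-- xᵢ < xⱼ ⇔ σᵢ < σⱼ and xⱼ < xᵢ ⇔ σⱼ < σᵢ
orderIsoᵇ : List ℕ → List ℕ → Bool
orderIsoᵇ []       []       = true
orderIsoᵇ (x ∷ xs) (s ∷ ss) = headCompat x xs s ss ∧ orderIsoᵇ xs ss
orderIsoᵇ _        _        = false

anyᵇ : {A : Set} → (A → Bool) → List A → Bool
anyᵇ p = foldr (λ x b → p x ∨ b) false

allᵇ : {A : Set} → (A → Bool) → List A → Bool
allᵇ p = foldr (λ x b → p x ∧ b) true

containsᵇ : List ℕ → List ℕ → Bool
containsᵇ σ w = anyᵇ (λ u → orderIsoᵇ u σ) (subseqs (length σ) w)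

avoidsᵇ : List ℕ → List ℕ → Bool
avoidsᵇ σ w = not (containsᵇ σ w)

δ : ℕ → List ℕ
δ k = map suc (downFrom k)

p1342 : List ℕ
p1342 = 1 ∷ 3 ∷ 4 ∷ 2 ∷ []

firstIsᵇ : ℕ → List ℕ → Bool
firstIsᵇ n []      = false
firstIsᵇ n (x ∷ _) = x ≡ᵇ n

goodᵇ : ℕ → ℕ → List ℕ → Bool
goodᵇ n k π = isCyclicᵇ π ∧ firstIsᵇ n π ∧ avoidsᵇ (δ k) π
              ∧ allᵇ (avoidsᵇ p1342) (rotations (cycleForm π))

b° : ℕ → ℕ → ℕ
b° n k = length (filterᵇ (goodᵇ n k) (perms n))

Series : Set
Series = ℕ → ℤ

sumℤ : List ℤ → ℤ
sumℤ = foldr _+_ (+ 0)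

_⊛_ : Series → Series → Series
(f ⊛ g) n = sumℤ (map (λ i → f i * g (n ∸ i)) (upTo (suc n)))

_⊝_ : Series → Series → Series
(f ⊝ g) n = f n - g n

zpow : ℕ → Series
zpow m n = if m ≡ᵇ n then + 1 else + 0

poly : List ℤ → Series
poly []       n       = + 0
poly (c ∷ cs) zero    = c
poly (c ∷ cs) (suc n) = poly cs n

_^ˢ_ : Series → ℕ → Series
f ^ˢ zero  = zpow 0
f ^ˢ suc m = f ⊛ (f ^ˢ m)

-- 1/(1 - a z) = Σ aⁿ zⁿ  (the inverse of the series 1 - a z)
invOneMinus : ℤ → Series
invOneMinus a n = a ℤ.^ n

B : ℕ → Series
B k zero    = + 0
B k (suc n) = + b° (suc n) k

-- z(1 - z - z²)/(1 - 2z) - z^{k+1} / ((1 - 2z)(1 - z)^{k-2})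
Bformula : ℕ → Series
Bformula k =
  ((poly (+ 0 ∷ + 1 ∷ ℤ.- + 1 ∷ ℤ.- + 1 ∷ [])) ⊛ invOneMinus (+ 2))
  ⊝ (zpow (suc k) ⊛ (invOneMinus (+ 2) ⊛ (invOneMinus (+ 1) ^ˢ (k ∸ 2))))

{-# OPTIONS --safe #-}

-- A cyclic π with π₁ = n has cycle form 1 n w, and every rotation of it avoids 1342 exactly when
-- each entry of w is the least or the greatest of the entries from it on (w avoids 213 and 231).
-- Such w are coded by the m = n - 3 choices least/greatest made before the last entry, and the
-- cycle form determines π. In the one-line notation of π a longest decreasing subsequence has
-- length 2 + c, where c counts the changes between least and greatest in the code preceded by one
-- "greatest" (the entry n); so π avoids δ k iff c < k - 2. Splitting codes by their first choice,
-- and using the symmetry least ↔ greatest, the number N m j of codes with c < j satisfies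
-- N (m + 1) (j + 1) = N m j + N m (j + 1) and N m 1 = 1. The series 1/((1 - 2z)(1 - z)^r) satisfy
-- the matching recurrence, because multiplying the (r + 1)-st by 1 - z gives the r-th, and the
-- first coefficients are checked directly.
module Submission where

open import Data.Bool using (Bool; true; false; T; not; _∧_; _∨_; if_then_else_)
open import Data.Bool.Properties using (T-∧; T-∨; T-≡; ∧-zeroʳ; ∨-assoc; ∨-identityʳ; ∧-identityʳ; ∧-distribˡ-∨)
open import Data.Empty using (⊥; ⊥-elim)
open import Data.Nat using (ℕ; zero; suc; _∸_; _⊔_; _≤_; _<_; z≤n; s≤s; _≡ᵇ_; _<ᵇ_; _≤ᵇ_; _≟_; _<?_)
open import Data.Nat.Properties
open import Algebra.Properties.CommutativeSemigroup ⊔-commutativeSemigroup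
  using () renaming (interchange to ⊔-interchange)
import Data.Nat as ℕ
import Data.Integer as ℤ
import Data.Integer.Properties as ℤ
open import Data.List using (List; []; _∷_; [_]; _++_; map; length; upTo; downFrom; filter; concatMap; take; drop)
open import Data.List.Properties
  using ( length-map; length-downFrom; length-++; length-++-sucʳ; length-upTo; filter-++; filter-none
        ; ∷-injectiveˡ; ∷-injectiveʳ; ∷ʳ-injectiveʳ; ++-assoc; ++-identityʳ; take++drop≡id)
open import Data.List.Membership.Propositional using (_∈_; _∉_)
open import Data.List.Membership.Propositional.Properties
  using (∈-++⁺ˡ; ∈-++⁺ʳ; ∈-++⁻; ∈-map⁺; ∈-map⁻; ∈-∃++; ∈-upTo⁺; ∈-upTo⁻; ∈-filter⁺; ∈-filter⁻)
open import Data.List.Membership.DecPropositional _≟_ using (_∈?_)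
open import Data.List.Relation.Unary.Any using (here; there)
open import Data.List.Relation.Unary.All using (All; []; _∷_)
import Data.List.Relation.Unary.All as All
import Data.List.Relation.Unary.All.Properties as All
open import Data.List.Relation.Unary.All.Properties using (All¬⇒¬Any; ¬Any⇒All¬)
open import Data.List.Relation.Unary.AllPairs using ([]; _∷_)
open import Data.List.Relation.Unary.Linked using (Linked; []; [-]; _∷_)
import Data.List.Relation.Unary.Linked as Linked
open import Data.List.Relation.Binary.Sublist.Propositional using (_⊆_; []; _∷_; _∷ʳ_; from∈)
import Data.List.Relation.Binary.Sublist.Propositional as Sublist
import Data.List.Relation.Binary.Sublist.Propositional.Properties as Sublist
open import Data.List.Relation.Binary.Pointwise using (Pointwise; []; _∷_)
open import Data.List.Relation.Unary.Unique.Propositional using (Unique)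
import Data.List.Relation.Unary.Unique.Propositional.Properties as Unique
open import Data.Product using (∃; ∃₂; _×_; _,_; proj₁; proj₂)
open import Data.Sum using (_⊎_; inj₁; inj₂)
open import Data.Unit using (tt)
open import Function using (_∘_; Equivalence)
open import Relation.Nullary using (¬_; Dec; yes; no)
open import Relation.Nullary.Decidable using (T?)
open import Relation.Binary.PropositionalEquality using (_≡_; _≢_; refl; sym; trans; cong; cong₂; subst; module ≡-Reasoning)

open import Defs

<ᵇ-true : ∀ {m n} → m < n → (m <ᵇ n) ≡ true
<ᵇ-true m<n = Equivalence.to T-≡ (<⇒<ᵇ m<n)

<ᵇ-false : ∀ {m n} → n ≤ m → (m <ᵇ n) ≡ false
<ᵇ-false {m} {n} n≤m with m <ᵇ n in eq
... | false = refl
... | true = ⊥-elim (<⇒≱ (<ᵇ⇒< m n (subst T (sym eq) tt)) n≤m)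

module PowerSeries where

  open import Data.Integer using (ℤ; +_; -_; _+_; _-_; _*_)
  open import Data.Integer.Tactic.RingSolver using (solve-∀)
  open import Data.List.Properties using (map-upTo; upTo-∷ʳ)
  open import Relation.Binary.Definitions using (Tri; tri<; tri≈; tri>)
  open ≡-Reasoning

  private
    upTo-suc : ∀ n → upTo (suc n) ≡ 0 ∷ map suc (upTo n)
    upTo-suc n = cong (0 ∷_) (sym (map-upTo suc n))

    sumℤ-++ : ∀ (f : ℕ → ℤ) xs ys → sumℤ (map f (xs ++ ys)) ≡ sumℤ (map f xs) + sumℤ (map f ys)
    sumℤ-++ f [] ys = sym (ℤ.+-identityˡ _)
    sumℤ-++ f (x ∷ xs) ys = trans (cong (_+_ (f x)) (sumℤ-++ f xs ys)) (sym (ℤ.+-assoc (f x) _ _))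

    sumℤ-cong : ∀ (f g : ℕ → ℤ) xs → (∀ {i} → i ∈ xs → f i ≡ g i) → sumℤ (map f xs) ≡ sumℤ (map g xs)
    sumℤ-cong f g [] _ = refl
    sumℤ-cong f g (x ∷ xs) f≗g = cong₂ _+_ (f≗g (here refl)) (sumℤ-cong f g xs (f≗g ∘ there))

    sumℤ-scale : ∀ a (f : ℕ → ℤ) xs → sumℤ (map (λ i → a * f i) xs) ≡ a * sumℤ (map f xs)
    sumℤ-scale a f [] = sym (ℤ.*-zeroʳ a)
    sumℤ-scale a f (x ∷ xs) = trans (cong (_+_ (a * f x)) (sumℤ-scale a f xs)) (sym (ℤ.*-distribˡ-+ a (f x) _))

    sumℤ-map-suc : ∀ (f : ℕ → ℤ) xs → sumℤ (map f (map suc xs)) ≡ sumℤ (map (f ∘ suc) xs)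
    sumℤ-map-suc f [] = refl
    sumℤ-map-suc f (x ∷ xs) = cong (_+_ (f (suc x))) (sumℤ-map-suc f xs)

  invOneMinus-⊛-zero : ∀ a S → (invOneMinus a ⊛ S) 0 ≡ S 0
  invOneMinus-⊛-zero a S = normalise (S 0)
    where
    normalise : ∀ s → + 1 * s + + 0 ≡ s
    normalise = solve-∀

  invOneMinus-⊛-suc : ∀ a S j → (invOneMinus a ⊛ S) (suc j) ≡ a * (invOneMinus a ⊛ S) j + S (suc j)
  invOneMinus-⊛-suc a S j = begin
    sumℤ (map F (upTo (suc (suc j))))                    ≡⟨ cong (sumℤ ∘ map F) (upTo-suc (suc j)) ⟩
    F 0 + sumℤ (map F (map suc (upTo (suc j))))          ≡⟨ cong (_+_ (F 0)) (sumℤ-map-suc F (upTo (suc j))) ⟩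
    F 0 + sumℤ (map (F ∘ suc) (upTo (suc j)))            ≡⟨ cong (_+_ (F 0)) (sumℤ-cong (F ∘ suc) (λ i → a * G i) (upTo (suc j))
                                                              λ {i} _ → ℤ.*-assoc a (a ℤ.^ i) (S (j ∸ i))) ⟩
    F 0 + sumℤ (map (λ i → a * G i) (upTo (suc j)))      ≡⟨ cong (_+_ (F 0)) (sumℤ-scale a G (upTo (suc j))) ⟩
    + 1 * S (suc j) + a * sumℤ (map G (upTo (suc j)))    ≡⟨ normalise a (S (suc j)) (sumℤ (map G (upTo (suc j)))) ⟩
    a * sumℤ (map G (upTo (suc j))) + S (suc j)          ∎
    where
    F G : ℕ → ℤ
    F i = a ℤ.^ i * S (suc j ∸ i)
    G i = a ℤ.^ i * S (j ∸ i)
    normalise : ∀ a s x → + 1 * s + a * x ≡ a * x + s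
    normalise = solve-∀

  ⊛-invOneMinus-suc : ∀ a S j → (S ⊛ invOneMinus a) (suc j) ≡ a * (S ⊛ invOneMinus a) j + S (suc j)
  ⊛-invOneMinus-suc a S j = begin
    sumℤ (map F (upTo (suc (suc j))))                                ≡⟨ cong (sumℤ ∘ map F) (sym (upTo-∷ʳ (suc j))) ⟩
    sumℤ (map F (upTo (suc j) ++ [ suc j ]))                         ≡⟨ sumℤ-++ F (upTo (suc j)) [ suc j ] ⟩
    sumℤ (map F (upTo (suc j))) + (F (suc j) + + 0)                  ≡⟨ cong₂ _+_ (sumℤ-cong F (λ i → a * G i) (upTo (suc j)) shift)
                                                                         (cong (λ e → S (suc j) * a ℤ.^ e + + 0) (n∸n≡0 j)) ⟩
    sumℤ (map (λ i → a * G i) (upTo (suc j))) + (S (suc j) * + 1 + + 0) ≡⟨ cong (_+ _) (sumℤ-scale a G (upTo (suc j))) ⟩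
    a * sumℤ (map G (upTo (suc j))) + (S (suc j) * + 1 + + 0)        ≡⟨ normalise a (S (suc j)) (sumℤ (map G (upTo (suc j)))) ⟩
    a * sumℤ (map G (upTo (suc j))) + S (suc j)                      ∎
    where
    F G : ℕ → ℤ
    F i = S i * a ℤ.^ (suc j ∸ i)
    G i = S i * a ℤ.^ (j ∸ i)
    shift : ∀ {i} → i ∈ upTo (suc j) → F i ≡ a * G i
    shift {i} i∈ rewrite +-∸-assoc 1 (≤-pred (∈-upTo⁻ i∈)) = swap a (S i) (a ℤ.^ (j ∸ i))
      where
      swap : ∀ a s p → s * (a * p) ≡ a * (s * p)
      swap = solve-∀
    normalise : ∀ a s x → a * x + (s * + 1 + + 0) ≡ a * x + s
    normalise = solve-∀

  private
    ≡ᵇ-refl : ∀ n → (n ≡ᵇ n) ≡ true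
    ≡ᵇ-refl n = Equivalence.to T-≡ (≡⇒≡ᵇ n n refl)

    ≡ᵇ-false : ∀ {m n} → m ≢ n → (m ≡ᵇ n) ≡ false
    ≡ᵇ-false {m} {n} m≢n with m ≡ᵇ n in eq
    ... | false = refl
    ... | true = ⊥-elim (m≢n (≡ᵇ⇒≡ m n (subst T (sym eq) tt)))

    sum-zpow : ∀ s (g : ℕ → ℤ) N → sumℤ (map (λ i → zpow s i * g i) (upTo N)) ≡ (if s <ᵇ N then g s else + 0)
    sum-zpow s g zero = refl
    sum-zpow s g (suc N) = begin
      sumℤ (map f (upTo (suc N)))                           ≡⟨ cong (sumℤ ∘ map f) (sym (upTo-∷ʳ N)) ⟩
      sumℤ (map f (upTo N ++ [ N ]))                        ≡⟨ sumℤ-++ f (upTo N) [ N ] ⟩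
      sumℤ (map f (upTo N)) + (f N + + 0)                   ≡⟨ cong (_+ (f N + + 0)) (sum-zpow s g N) ⟩
      (if s <ᵇ N then g s else + 0) + (f N + + 0)           ≡⟨ last (<-cmp s N) ⟩
      (if s <ᵇ suc N then g s else + 0)                     ∎
      where
      f : ℕ → ℤ
      f i = zpow s i * g i
      last : Tri (s < N) (s ≡ N) (N < s) → (if s <ᵇ N then g s else + 0) + (f N + + 0) ≡ (if s <ᵇ suc N then g s else + 0)
      last (tri< s<N s≢N _) rewrite <ᵇ-true s<N | <ᵇ-true (m<n⇒m<1+n s<N) | ≡ᵇ-false s≢N = normalise (g s) (g N)
        where
        normalise : ∀ x y → x + (+ 0 * y + + 0) ≡ x
        normalise = solve-∀
      last (tri≈ _ refl _) rewrite <ᵇ-false (≤-refl {s}) | <ᵇ-true (n<1+n s) | ≡ᵇ-refl s = normalise (g s)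
        where
        normalise : ∀ x → + 0 + (+ 1 * x + + 0) ≡ x
        normalise = solve-∀
      last (tri> _ s≢N N<s) rewrite <ᵇ-false (<⇒≤ N<s) | <ᵇ-false {s} {suc N} N<s | ≡ᵇ-false s≢N = normalise (g N)
        where
        normalise : ∀ y → + 0 + (+ 0 * y + + 0) ≡ + 0
        normalise = solve-∀

  zpow-⊛-below : ∀ s S {m} → m < s → (zpow s ⊛ S) m ≡ + 0
  zpow-⊛-below s S {m} m<s rewrite sum-zpow s (λ i → S (m ∸ i)) (suc m) | <ᵇ-false {s} {suc m} m<s = refl

  zpow-⊛-shift : ∀ s S j → (zpow s ⊛ S) (s ℕ.+ j) ≡ S j
  zpow-⊛-shift s S j rewrite sum-zpow s (λ i → S (s ℕ.+ j ∸ i)) (suc (s ℕ.+ j)) | <ᵇ-true (s≤s (m≤m+n s j)) =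
    cong S (m+n∸m≡n s j)

  -- Bformula k is firstTerm ⊝ (zpow (suc k) ⊛ tailFactor (k ∸ 2)), definitionally
  numerator : Series
  numerator = poly (+ 0 ∷ + 1 ∷ - + 1 ∷ - + 1 ∷ [])

  firstTerm : Series
  firstTerm = numerator ⊛ invOneMinus (+ 2)

  geometricPower : ℕ → Series
  geometricPower r = invOneMinus (+ 1) ^ˢ r

  tailFactor : ℕ → Series
  tailFactor r = invOneMinus (+ 2) ⊛ geometricPower r

  firstTerm-rec : ∀ j → firstTerm (4 ℕ.+ j) ≡ + 2 * firstTerm (3 ℕ.+ j)
  firstTerm-rec j = trans (⊛-invOneMinus-suc (+ 2) numerator (3 ℕ.+ j)) (ℤ.+-identityʳ (+ 2 * firstTerm (3 ℕ.+ j)))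

  geometricPower-one : ∀ j → geometricPower 1 j ≡ + 1
  geometricPower-one zero = refl
  geometricPower-one (suc j) = trans (invOneMinus-⊛-suc (+ 1) (geometricPower 0) j) (cong (λ t → + 1 * t + + 0) (geometricPower-one j))

  tailFactor-zero : ∀ r → tailFactor (suc r) 0 ≡ tailFactor r 0
  tailFactor-zero r = trans (invOneMinus-⊛-zero (+ 2) (geometricPower (suc r)))
                            (trans (invOneMinus-⊛-zero (+ 1) (geometricPower r)) (sym (invOneMinus-⊛-zero (+ 2) (geometricPower r))))

  private
    tailFactor-step : ∀ r j → tailFactor (suc r) j + geometricPower (suc r) (suc j) ≡ tailFactor r (suc j)
    tailFactor-step r zero = begin
      tailFactor (suc r) 0 + geometricPower (suc r) 1
        ≡⟨ cong₂ _+_ (trans (invOneMinus-⊛-zero (+ 2) (geometricPower (suc r))) (invOneMinus-⊛-zero (+ 1) P))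
                     (trans (invOneMinus-⊛-suc (+ 1) P 0) (cong (λ t → + 1 * t + P 1) (invOneMinus-⊛-zero (+ 1) P))) ⟩
      P 0 + (+ 1 * P 0 + P 1)
        ≡⟨ normalise (P 0) (P 1) ⟩
      + 2 * P 0 + P 1
        ≡⟨ sym (trans (invOneMinus-⊛-suc (+ 2) P 0) (cong (λ t → + 2 * t + P 1) (invOneMinus-⊛-zero (+ 2) P))) ⟩
      tailFactor r 1
        ∎
      where
      P : Series
      P = geometricPower r
      normalise : ∀ x y → x + (+ 1 * x + y) ≡ + 2 * x + y
      normalise = solve-∀
    tailFactor-step r (suc j) = begin
      tailFactor (suc r) (suc j) + geometricPower (suc r) (suc (suc j))
        ≡⟨ cong₂ _+_ (invOneMinus-⊛-suc (+ 2) (geometricPower (suc r)) j) (invOneMinus-⊛-suc (+ 1) P (suc j)) ⟩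
      (+ 2 * tailFactor (suc r) j + geometricPower (suc r) (suc j)) + (+ 1 * geometricPower (suc r) (suc j) + P (suc (suc j)))
        ≡⟨ normalise (tailFactor (suc r) j) (geometricPower (suc r) (suc j)) (P (suc (suc j))) ⟩
      + 2 * (tailFactor (suc r) j + geometricPower (suc r) (suc j)) + P (suc (suc j))
        ≡⟨ cong (λ t → + 2 * t + P (suc (suc j))) (tailFactor-step r j) ⟩
      + 2 * tailFactor r (suc j) + P (suc (suc j))
        ≡⟨ sym (invOneMinus-⊛-suc (+ 2) P (suc j)) ⟩
      tailFactor r (suc (suc j))
        ∎
      where
      P : Series
      P = geometricPower r
      normalise : ∀ h p p₂ → (+ 2 * h + p) + (+ 1 * p + p₂) ≡ + 2 * (h + p) + p₂
      normalise = solve-∀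

  -- (1 - z) · tailFactor (r + 1) = tailFactor r
  tailFactor-rec : ∀ r j → tailFactor (suc r) (suc j) ≡ tailFactor (suc r) j + tailFactor r (suc j)
  tailFactor-rec r j = begin
    tailFactor (suc r) (suc j)
      ≡⟨ invOneMinus-⊛-suc (+ 2) (geometricPower (suc r)) j ⟩
    + 2 * tailFactor (suc r) j + geometricPower (suc r) (suc j)
      ≡⟨ normalise (tailFactor (suc r) j) (geometricPower (suc r) (suc j)) ⟩
    tailFactor (suc r) j + (tailFactor (suc r) j + geometricPower (suc r) (suc j))
      ≡⟨ cong (_+_ (tailFactor (suc r) j)) (tailFactor-step r j) ⟩
    tailFactor (suc r) j + tailFactor r (suc j)
      ∎
    where
    normalise : ∀ h p → + 2 * h + p ≡ h + (h + p)
    normalise = solve-∀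

  private
    shifted-tailFactor-rec : ∀ q k M → (zpow (suc k) ⊛ tailFactor (suc q)) (suc M)
                                       ≡ (zpow (suc k) ⊛ tailFactor (suc q)) M + (zpow k ⊛ tailFactor q) M
    shifted-tailFactor-rec q k M with <-cmp M k
    ... | tri< M<k _ _ =
      trans (zpow-⊛-below (suc k) (tailFactor (suc q)) (s≤s M<k))
            (sym (cong₂ _+_ (zpow-⊛-below (suc k) (tailFactor (suc q)) (m<n⇒m<1+n M<k)) (zpow-⊛-below k (tailFactor q) M<k)))
    ... | tri≈ _ refl _ = begin
      (zpow (suc M) ⊛ tailFactor (suc q)) (suc M)
        ≡⟨ cong (zpow (suc M) ⊛ tailFactor (suc q)) (cong suc (sym (+-identityʳ M))) ⟩
      (zpow (suc M) ⊛ tailFactor (suc q)) (suc M ℕ.+ 0)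
        ≡⟨ zpow-⊛-shift (suc M) (tailFactor (suc q)) 0 ⟩
      tailFactor (suc q) 0
        ≡⟨ tailFactor-zero q ⟩
      tailFactor q 0
        ≡⟨ sym (zpow-⊛-shift M (tailFactor q) 0) ⟩
      (zpow M ⊛ tailFactor q) (M ℕ.+ 0)
        ≡⟨ cong (zpow M ⊛ tailFactor q) (+-identityʳ M) ⟩
      (zpow M ⊛ tailFactor q) M
        ≡⟨ sym (ℤ.+-identityˡ _) ⟩
      + 0 + (zpow M ⊛ tailFactor q) M
        ≡⟨ cong (_+ (zpow M ⊛ tailFactor q) M) (sym (zpow-⊛-below (suc M) (tailFactor (suc q)) (n<1+n M))) ⟩
      (zpow (suc M) ⊛ tailFactor (suc q)) M + (zpow M ⊛ tailFactor q) M
        ∎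
    ... | tri> _ _ k<M with j , refl ← m≤n⇒∃[o]m+o≡n k<M = begin
      (zpow (suc k) ⊛ tailFactor (suc q)) (suc (suc k ℕ.+ j))
        ≡⟨ cong (zpow (suc k) ⊛ tailFactor (suc q)) (cong suc (sym (+-suc k j))) ⟩
      (zpow (suc k) ⊛ tailFactor (suc q)) (suc k ℕ.+ suc j)
        ≡⟨ zpow-⊛-shift (suc k) (tailFactor (suc q)) (suc j) ⟩
      tailFactor (suc q) (suc j)
        ≡⟨ tailFactor-rec q j ⟩
      tailFactor (suc q) j + tailFactor q (suc j)
        ≡⟨ sym (cong₂ _+_ (zpow-⊛-shift (suc k) (tailFactor (suc q)) j) shifted) ⟩
      (zpow (suc k) ⊛ tailFactor (suc q)) (suc k ℕ.+ j) + (zpow k ⊛ tailFactor q) (suc k ℕ.+ j)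
        ∎
      where
      shifted : (zpow k ⊛ tailFactor q) (suc k ℕ.+ j) ≡ tailFactor q (suc j)
      shifted = trans (cong (zpow k ⊛ tailFactor q) (sym (+-suc k j))) (zpow-⊛-shift k (tailFactor q) (suc j))

  Bformula-rec : ∀ r j → Bformula (4 ℕ.+ r) (4 ℕ.+ j) ≡ Bformula (4 ℕ.+ r) (3 ℕ.+ j) + Bformula (3 ℕ.+ r) (3 ℕ.+ j)
  Bformula-rec r j =
    trans (cong₂ _-_ (firstTerm-rec j) (shifted-tailFactor-rec (suc r) (4 ℕ.+ r) (3 ℕ.+ j)))
          (regroup (firstTerm (3 ℕ.+ j)) ((zpow (5 ℕ.+ r) ⊛ tailFactor (2 ℕ.+ r)) (3 ℕ.+ j))
                   ((zpow (4 ℕ.+ r) ⊛ tailFactor (suc r)) (3 ℕ.+ j)))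
    where
    regroup : ∀ a z₁ z₂ → + 2 * a - (z₁ + z₂) ≡ (a - z₁) + (a - z₂)
    regroup = solve-∀

  Bformula-3 : ∀ j → Bformula 3 (4 ℕ.+ j) ≡ + 1
  Bformula-3 j = trans (cong (_-_ (firstTerm (4 ℕ.+ j))) (zpow-⊛-shift 4 (tailFactor 1) j)) (difference j)
    where
    difference : ∀ j → firstTerm (4 ℕ.+ j) - tailFactor 1 j ≡ + 1
    difference zero = refl
    difference (suc j) = begin
      firstTerm (5 ℕ.+ j) - tailFactor 1 (suc j)
        ≡⟨ cong₂ _-_ (firstTerm-rec (suc j)) (trans (invOneMinus-⊛-suc (+ 2) (geometricPower 1) j)
                                                    (cong (_+_ (+ 2 * tailFactor 1 j)) (geometricPower-one (suc j)))) ⟩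
      + 2 * firstTerm (4 ℕ.+ j) - (+ 2 * tailFactor 1 j + + 1)
        ≡⟨ regroup (firstTerm (4 ℕ.+ j)) (tailFactor 1 j) ⟩
      + 2 * (firstTerm (4 ℕ.+ j) - tailFactor 1 j) - + 1
        ≡⟨ cong (λ t → + 2 * t - + 1) (difference j) ⟩
      + 1 ∎
      where
      regroup : ∀ a h → + 2 * a - (+ 2 * h + + 1) ≡ + 2 * (a - h) - + 1
      regroup = solve-∀

  Bformula-initial : ∀ k {m} → m ≤ k → Bformula k m ≡ firstTerm m
  Bformula-initial k {m} m≤k =
    trans (cong (_-_ (firstTerm m)) (zpow-⊛-below (suc k) (tailFactor (k ∸ 2)) (s≤s m≤k))) (ℤ.+-identityʳ (firstTerm m))

-- opened only now because PowerSeries uses ℤ's _+_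
open import Data.Nat using (_+_)

private
  variable
    A : Set

elemᵇ⇒∈ : ∀ x xs → T (elemᵇ x xs) → x ∈ xs
elemᵇ⇒∈ x (y ∷ ys) t with Equivalence.to T-∨ t
... | inj₁ x≡y = here (≡ᵇ⇒≡ x y x≡y)
... | inj₂ x∈ys = there (elemᵇ⇒∈ x ys x∈ys)

∈⇒elemᵇ : ∀ {x xs} → x ∈ xs → T (elemᵇ x xs)
∈⇒elemᵇ {x} (here refl) = Equivalence.from T-∨ (inj₁ (≡⇒≡ᵇ x x refl))
∈⇒elemᵇ (there x∈xs) = Equivalence.from T-∨ (inj₂ (∈⇒elemᵇ x∈xs))

distinctᵇ⇒Unique : ∀ xs → T (distinctᵇ xs) → Unique xs
distinctᵇ⇒Unique [] _ = []
distinctᵇ⇒Unique (x ∷ xs) t with elemᵇ x xs in eq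
... | false = ¬Any⇒All¬ xs (λ x∈xs → subst T eq (∈⇒elemᵇ x∈xs)) ∷ distinctᵇ⇒Unique xs t

Unique⇒distinctᵇ : ∀ {xs} → Unique xs → T (distinctᵇ xs)
Unique⇒distinctᵇ [] = tt
Unique⇒distinctᵇ {x ∷ xs} (x∉xs ∷ u) with elemᵇ x xs in eq
... | false = Unique⇒distinctᵇ u
... | true = All¬⇒¬Any x∉xs (elemᵇ⇒∈ x xs (subst T (sym eq) tt))

filterᵇ≡filter : ∀ (p : A → Bool) xs → filterᵇ p xs ≡ filter (T? ∘ p) xs
filterᵇ≡filter p [] = refl
filterᵇ≡filter p (x ∷ xs) with p x
... | true = cong (x ∷_) (filterᵇ≡filter p xs)
... | false = filterᵇ≡filter p xs

anyᵇ⁻ : ∀ (p : A → Bool) xs → T (anyᵇ p xs) → ∃ λ x → x ∈ xs × T (p x)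
anyᵇ⁻ p (x ∷ xs) t with Equivalence.to T-∨ t
... | inj₁ px = x , here refl , px
... | inj₂ t′ = let y , y∈xs , py = anyᵇ⁻ p xs t′ in y , there y∈xs , py

anyᵇ⁺ : ∀ (p : A → Bool) {xs x} → x ∈ xs → T (p x) → T (anyᵇ p xs)
anyᵇ⁺ p (here refl) px = Equivalence.from T-∨ (inj₁ px)
anyᵇ⁺ p (there x∈xs) px = Equivalence.from T-∨ (inj₂ (anyᵇ⁺ p x∈xs px))

allᵇ⁻ : ∀ (p : A → Bool) xs → T (allᵇ p xs) → ∀ {x} → x ∈ xs → T (p x)
allᵇ⁻ p (y ∷ ys) t (here refl) = proj₁ (Equivalence.to T-∧ t)
allᵇ⁻ p (y ∷ ys) t (there x∈ys) = allᵇ⁻ p ys (proj₂ (Equivalence.to T-∧ t)) x∈ys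

allᵇ⁺ : ∀ (p : A → Bool) xs → (∀ {x} → x ∈ xs → T (p x)) → T (allᵇ p xs)
allᵇ⁺ p [] _ = tt
allᵇ⁺ p (y ∷ ys) f = Equivalence.from T-∧ (f (here refl) , allᵇ⁺ p ys (f ∘ there))

T-not⁻ : ∀ {b} → T (not b) → ¬ T b
T-not⁻ {false} _ ()

T-not⁺ : ∀ {b} → ¬ T b → T (not b)
T-not⁺ {false} _ = tt
T-not⁺ {true} ¬t = ¬t tt

Unique-length-≤ : ∀ {xs ys : List A} → Unique xs → (∀ {z} → z ∈ xs → z ∈ ys) → length xs ≤ length ys
Unique-length-≤ {xs = []} _ _ = z≤n
Unique-length-≤ {xs = x ∷ xs} (x∉xs ∷ u) xs⊆ys with ∈-∃++ (xs⊆ys (here refl))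
... | ys₁ , ys₂ , refl rewrite length-++-sucʳ ys₁ x ys₂ =
  s≤s (Unique-length-≤ u (λ z∈xs → remove ys₁ (xs⊆ys (there z∈xs)) (All.lookup x∉xs z∈xs ∘ sym)))
  where
  remove : ∀ {z} ys₁ → z ∈ ys₁ ++ x ∷ ys₂ → z ≢ x → z ∈ ys₁ ++ ys₂
  remove [] (here z≡x) z≢x = ⊥-elim (z≢x z≡x)
  remove [] (there z∈ys₂) _ = z∈ys₂
  remove (y ∷ ys₁) (here z≡y) _ = here z≡y
  remove (y ∷ ys₁) (there z∈) z≢x = there (remove ys₁ z∈ z≢x)

Unique-length-≡ : ∀ {xs ys : List A} → Unique xs → Unique ys →
                  (∀ {z} → z ∈ xs → z ∈ ys) → (∀ {z} → z ∈ ys → z ∈ xs) → length xs ≡ length ys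
Unique-length-≡ uxs uys xs⊆ys ys⊆xs = ≤-antisym (Unique-length-≤ uxs xs⊆ys) (Unique-length-≤ uys ys⊆xs)

infix 4 _∈[_⋯_]

_∈[_⋯_] : ℕ → ℕ → ℕ → Set
v ∈[ lo ⋯ hi ] = lo ≤ v × v ≤ hi

∈-interval : ∀ lo m {v} → v ∈[ lo ⋯ lo + m ] → v ∈ map (lo +_) (upTo (suc m))
∈-interval lo m (lo≤v , v≤hi) =
  subst (_∈ map (lo +_) (upTo (suc m))) (m+[n∸m]≡n lo≤v)
        (∈-map⁺ (lo +_) (∈-upTo⁺ (s≤s (subst (_ ≤_) (m+n∸m≡n lo m) (∸-monoˡ-≤ lo v≤hi)))))

Unique-fills-interval : ∀ {lo m w} → Unique w → length w ≡ suc m → All (_∈[ lo ⋯ lo + m ]) w →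
                        ∀ {v} → v ∈[ lo ⋯ lo + m ] → v ∈ w
Unique-fills-interval {lo} {m} {w} uw |w| w⊆ {v} v∈ with v ∈? w
... | yes v∈w = v∈w
... | no v∉w = ⊥-elim (<-irrefl refl (begin-strict
  suc m                                 ≡⟨ sym |w| ⟩
  length w                              <⟨ Unique-length-≤ (¬Any⇒All¬ w v∉w ∷ uw) inInterval ⟩
  length (map (lo +_) (upTo (suc m)))   ≡⟨ trans (length-map (lo +_) (upTo (suc m))) (length-upTo (suc m)) ⟩
  suc m                                 ∎))
  where
  open ≤-Reasoning
  inInterval : ∀ {z} → z ∈ v ∷ w → z ∈ map (lo +_) (upTo (suc m))
  inInterval (here refl) = ∈-interval lo m v∈
  inInterval (there z∈w) = ∈-interval lo m (All.lookup w⊆ z∈w)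

private
  prefixAll : List ℕ → List (List ℕ) → List (List ℕ)
  prefixAll hs W = concatMap (λ x → map (x ∷_) W) hs

  ∈-prefixAll⁻ : ∀ hs W {u} → u ∈ prefixAll hs W → ∃₂ λ x u′ → u ≡ x ∷ u′ × x ∈ hs × u′ ∈ W
  ∈-prefixAll⁻ (h ∷ hs) W u∈ with ∈-++⁻ (map (h ∷_) W) u∈
  ... | inj₁ u∈hW = let u′ , u′∈W , u≡ = ∈-map⁻ (h ∷_) u∈hW in h , u′ , u≡ , here refl , u′∈W
  ... | inj₂ u∈rest = let x , u′ , u≡ , x∈hs , u′∈W = ∈-prefixAll⁻ hs W u∈rest in x , u′ , u≡ , there x∈hs , u′∈W

  ∈-prefixAll⁺ : ∀ hs W {x u′} → x ∈ hs → u′ ∈ W → x ∷ u′ ∈ prefixAll hs W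
  ∈-prefixAll⁺ (h ∷ hs) W (here refl) u′∈W = ∈-++⁺ˡ (∈-map⁺ (h ∷_) u′∈W)
  ∈-prefixAll⁺ (h ∷ hs) W (there x∈hs) u′∈W = ∈-++⁺ʳ (map (h ∷_) W) (∈-prefixAll⁺ hs W x∈hs u′∈W)

  Unique-prefixAll : ∀ {hs W} → Unique hs → Unique W → Unique (prefixAll hs W)
  Unique-prefixAll {[]} _ _ = []
  Unique-prefixAll {h ∷ hs} {W} (h∉hs ∷ uhs) uW =
    Unique.++⁺ (Unique.map⁺ ∷-injectiveʳ uW) (Unique-prefixAll uhs uW) disjoint
    where
    disjoint : ∀ {u} → ¬ (u ∈ map (h ∷_) W × u ∈ prefixAll hs W)
    disjoint (u∈hW , u∈rest) with ∈-map⁻ (h ∷_) u∈hW | ∈-prefixAll⁻ hs W u∈rest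
    ... | _ , _ , refl | x , _ , u≡ , x∈hs , _ = All.lookup h∉hs x∈hs (∷-injectiveˡ u≡)

  ∈-heads⁻ : ∀ n {v} → v ∈ map suc (upTo n) → v ∈[ 1 ⋯ n ]
  ∈-heads⁻ n v∈ with ∈-map⁻ suc v∈
  ... | _ , i∈ , refl = s≤s z≤n , ∈-upTo⁻ i∈

  ∈-heads⁺ : ∀ n {v} → v ∈[ 1 ⋯ n ] → v ∈ map suc (upTo n)
  ∈-heads⁺ n {suc v} (_ , v<n) = ∈-map⁺ suc (∈-upTo⁺ v<n)

∈-words⁻ : ∀ m n {u} → u ∈ words m n → length u ≡ m × All (_∈[ 1 ⋯ n ]) u
∈-words⁻ zero n (here refl) = refl , []
∈-words⁻ (suc m) n u∈ with ∈-prefixAll⁻ (map suc (upTo n)) (words m n) u∈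
... | _ , u′ , refl , x∈ , u′∈ = let |u′| , u′⊆ = ∈-words⁻ m n u′∈ in cong suc |u′| , ∈-heads⁻ n x∈ ∷ u′⊆

∈-words⁺ : ∀ {m n} u → length u ≡ m → All (_∈[ 1 ⋯ n ]) u → u ∈ words m n
∈-words⁺ [] refl [] = here refl
∈-words⁺ {n = n} (x ∷ u) refl (x∈ ∷ u⊆) = ∈-prefixAll⁺ (map suc (upTo n)) _ (∈-heads⁺ n x∈) (∈-words⁺ u refl u⊆)

Unique-words : ∀ m n → Unique (words m n)
Unique-words zero n = [] ∷ []
Unique-words (suc m) n = Unique-prefixAll (Unique.map⁺ suc-injective (Unique.upTo⁺ n)) (Unique-words m n)

IsPermutation : ℕ → List ℕ → Set
IsPermutation n π = length π ≡ n × All (_∈[ 1 ⋯ n ]) π × Unique π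

perms≡filter : ∀ n → perms n ≡ filter (T? ∘ distinctᵇ) (words n n)
perms≡filter n = filterᵇ≡filter distinctᵇ (words n n)

∈-perms⁻ : ∀ n {π} → π ∈ perms n → IsPermutation n π
∈-perms⁻ n π∈ with ∈-filter⁻ (T? ∘ distinctᵇ) (subst (_ ∈_) (perms≡filter n) π∈)
... | π∈words , distinct = let |π| , π⊆ = ∈-words⁻ n n π∈words in |π| , π⊆ , distinctᵇ⇒Unique _ distinct

∈-perms⁺ : ∀ n {π} → IsPermutation n π → π ∈ perms n
∈-perms⁺ n {π} (|π| , π⊆ , uπ) =
  subst (π ∈_) (sym (perms≡filter n)) (∈-filter⁺ (T? ∘ distinctᵇ) (∈-words⁺ π |π| π⊆) (Unique⇒distinctᵇ uπ))

Unique-perms : ∀ n → Unique (perms n)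
Unique-perms n = subst Unique (sym (perms≡filter n)) (Unique.filter⁺ (T? ∘ distinctᵇ) (Unique-words n n))

app-∈ : ∀ π {i} → i ∈[ 1 ⋯ length π ] → app π i ∈ π
app-∈ (x ∷ π) {suc zero} _ = here refl
app-∈ (x ∷ π) {suc (suc i)} (_ , s≤s i≤) = there (app-∈ π (s≤s z≤n , i≤))

∈⇒app : ∀ π {x} → x ∈ π → ∃ λ i → i ∈[ 1 ⋯ length π ] × app π i ≡ x
∈⇒app (y ∷ π) (here refl) = 1 , (s≤s z≤n , s≤s z≤n) , refl
∈⇒app (y ∷ π) (there x∈π) with ∈⇒app π x∈π
... | suc i , (_ , i≤) , app≡x = suc (suc i) , (s≤s z≤n , s≤s i≤) , app≡x

app-ext : ∀ π σ → length π ≡ length σ → (∀ {i} → i ∈[ 1 ⋯ length π ] → app π i ≡ app σ i) → π ≡ σ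
app-ext [] [] _ _ = refl
app-ext (x ∷ π) (y ∷ σ) |π|≡|σ| same =
  cong₂ _∷_ (same (s≤s z≤n , s≤s z≤n))
            (app-ext π σ (suc-injective |π|≡|σ|) λ { {suc i} (_ , i≤) → same (s≤s z≤n , s≤s i≤) })

Iterates : (ℕ → ℕ) → List ℕ → Set
Iterates f = Linked (λ x y → f x ≡ y)

orbit-iterates : ∀ π m c → Iterates (app π) (orbit π m c)
orbit-iterates π zero c = []
orbit-iterates π (suc zero) c = [-]
orbit-iterates π (suc (suc m)) c = refl ∷ orbit-iterates π (suc m) (app π c)

iterates⇒orbit : ∀ π c cs → Iterates (app π) (c ∷ cs) → orbit π (suc (length cs)) c ≡ c ∷ cs
iterates⇒orbit π c [] _ = refl
iterates⇒orbit π c (y ∷ cs) (refl ∷ it) = cong (c ∷_) (iterates⇒orbit π y cs it)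

iterates-step : ∀ {f x y post} pre → Iterates f (pre ++ x ∷ y ∷ post) → f x ≡ y
iterates-step [] (fx≡y ∷ _) = fx≡y
iterates-step (_ ∷ pre) it = iterates-step pre (Linked.tail it)

iterates-cong : ∀ {f g} l → (∀ {a} → a ∈ l → f a ≡ g a) → Iterates f l → Iterates g l
iterates-cong [] _ [] = []
iterates-cong (x ∷ []) _ [-] = [-]
iterates-cong (x ∷ y ∷ l) f≗g (fx≡y ∷ it) = trans (sym (f≗g (here refl))) fx≡y ∷ iterates-cong (y ∷ l) (f≗g ∘ there) it

length-orbit : ∀ π m c → length (orbit π m c) ≡ m
length-orbit π zero c = refl
length-orbit π (suc m) c = cong suc (length-orbit π m (app π c))

orbit-bounded : ∀ {n π} → IsPermutation n π → ∀ m {c} → c ∈[ 1 ⋯ n ] → All (_∈[ 1 ⋯ n ]) (orbit π m c)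
orbit-bounded _ zero _ = []
orbit-bounded {π = π} P@(refl , π⊆ , _) (suc m) c∈ = c∈ ∷ orbit-bounded P m (All.lookup π⊆ (app-∈ π c∈))

private
  head-unrepeated : ∀ {x q : ℕ} {xs post} pre → Unique (x ∷ xs) → x ∷ xs ≢ pre ++ q ∷ x ∷ post
  head-unrepeated [] (x∉ ∷ _) refl = All¬⇒¬Any x∉ (here refl)
  head-unrepeated (_ ∷ pre) (x∉ ∷ _) refl = All¬⇒¬Any x∉ (∈-++⁺ʳ pre (there (here refl)))

cycleForm-fills : ∀ {n π} → IsPermutation (suc n) π → Unique (cycleForm π) →
                  ∀ {v} → v ∈[ 1 ⋯ suc n ] → v ∈ cycleForm π
cycleForm-fills {π = π} P@(|π| , _) unique =
  Unique-fills-interval unique (trans (length-orbit π _ 1) |π|) (orbit-bounded P (length π) (s≤s z≤n , s≤s z≤n))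

cycleForm-last↦1 : ∀ {n π} → IsPermutation (suc n) π → Unique (cycleForm π) →
                   ∀ pre i → cycleForm π ≡ pre ++ [ i ] → app π i ≡ 1
cycleForm-last↦1 {n} {π} P@(|π| , π⊆ , uπ) unique pre i cf≡
  with ∈⇒app π (Unique-fills-interval uπ |π| π⊆ (s≤s z≤n , s≤s z≤n))
... | q , q∈ , πq≡1 with ∈-∃++ (cycleForm-fills P unique (subst (q ∈[ 1 ⋯_]) |π| q∈))
...   | pre′ , [] , cf≡′ = subst (λ j → app π j ≡ 1) (sym (∷ʳ-injectiveʳ pre pre′ (trans (sym cf≡) cf≡′))) πq≡1
...   | pre′ , y ∷ post , cf≡′ =
  ⊥-elim (head-unrepeated pre′ (subst Unique cf≡1∷ unique)
            (trans (sym cf≡1∷) (trans cf≡′ (cong (λ z → pre′ ++ q ∷ z ∷ post) y≡1))))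
  where
  cf≡1∷ : cycleForm π ≡ 1 ∷ orbit π n (app π 1)
  cf≡1∷ = cong (λ L → orbit π L 1) |π|
  y≡1 : y ≡ 1
  y≡1 = trans (sym (iterates-step pre′ (subst (Iterates (app π)) cf≡′ (orbit-iterates π (length π) 1)))) πq≡1

cycleForm-injective : ∀ {n π σ} → IsPermutation (suc n) π → IsPermutation (suc n) σ →
                      Unique (cycleForm π) → cycleForm π ≡ cycleForm σ → π ≡ σ
cycleForm-injective {π = π} {σ} Pπ@(|π| , _) Pσ@(|σ| , _) unique cf≡ = app-ext π σ (trans |π| (sym |σ|)) same
  where
  same : ∀ {i} → i ∈[ 1 ⋯ length π ] → app π i ≡ app σ i
  same {i} i∈ with ∈-∃++ (cycleForm-fills Pπ unique (subst (i ∈[ 1 ⋯_]) |π| i∈))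
  ... | pre , [] , cf≡′ =
    trans (cycleForm-last↦1 Pπ unique pre i cf≡′)
          (sym (cycleForm-last↦1 Pσ (subst Unique cf≡ unique) pre i (trans (sym cf≡) cf≡′)))
  ... | pre , y ∷ post , cf≡′ =
    trans (iterates-step pre (subst (Iterates (app π)) cf≡′ (orbit-iterates π (length π) 1)))
          (sym (iterates-step pre (subst (Iterates (app σ)) (trans (sym cf≡) cf≡′) (orbit-iterates σ (length σ) 1))))

-- Words in which every entry is the least or the greatest of the entries from it on

data Pick : Set where
  least greatest : Pick

extremalHead : ℕ → List Pick → ℕ
extremalHead a [] = a
extremalHead a (least ∷ ps) = a
extremalHead a (greatest ∷ ps) = suc (a + length ps)

mutual
  extremal : ℕ → List Pick → List ℕ
  extremal a ps = extremalHead a ps ∷ extremalTail a ps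

  extremalTail : ℕ → List Pick → List ℕ
  extremalTail a [] = []
  extremalTail a (least ∷ ps) = extremal (suc a) ps
  extremalTail a (greatest ∷ ps) = extremal a ps

length-extremal : ∀ a ps → length (extremal a ps) ≡ suc (length ps)
length-extremal a [] = refl
length-extremal a (least ∷ ps) = cong suc (length-extremal (suc a) ps)
length-extremal a (greatest ∷ ps) = cong suc (length-extremal a ps)

private
  extend-down : ∀ a m {v} → v ∈[ suc a ⋯ suc a + m ] → v ∈[ a ⋯ a + suc m ]
  extend-down a m {v} (a<v , v≤) = ≤-trans (n≤1+n a) a<v , subst (v ≤_) (sym (+-suc a m)) v≤

  extend-up : ∀ a m {v} → v ∈[ a ⋯ a + m ] → v ∈[ a ⋯ a + suc m ]
  extend-up a m (a≤v , v≤) = a≤v , ≤-trans v≤ (+-monoʳ-≤ a (n≤1+n m))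

extremalHead-bounded : ∀ a ps → extremalHead a ps ∈[ a ⋯ a + length ps ]
extremalHead-bounded a [] = ≤-refl , m≤m+n a 0
extremalHead-bounded a (least ∷ ps) = ≤-refl , m≤m+n a (suc (length ps))
extremalHead-bounded a (greatest ∷ ps) = m≤n⇒m≤1+n (m≤m+n a (length ps)) , ≤-reflexive (sym (+-suc a (length ps)))

extremal-bounded : ∀ a ps → All (_∈[ a ⋯ a + length ps ]) (extremal a ps)
extremal-bounded a [] = extremalHead-bounded a [] ∷ []
extremal-bounded a (least ∷ ps) =
  extremalHead-bounded a (least ∷ ps) ∷ All.map (extend-down a (length ps)) (extremal-bounded (suc a) ps)
extremal-bounded a (greatest ∷ ps) =
  extremalHead-bounded a (greatest ∷ ps) ∷ All.map (extend-up a (length ps)) (extremal-bounded a ps)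

Unique-extremal : ∀ a ps → Unique (extremal a ps)
Unique-extremal a [] = [] ∷ []
Unique-extremal a (least ∷ ps) =
  All.map (λ (a<v , _) → <⇒≢ a<v) (extremal-bounded (suc a) ps) ∷ Unique-extremal (suc a) ps
Unique-extremal a (greatest ∷ ps) =
  All.map (λ (_ , v≤) → >⇒≢ (s≤s v≤)) (extremal-bounded a ps) ∷ Unique-extremal a ps

extremal-injective : ∀ a {ps qs} → extremal a ps ≡ extremal a qs → ps ≡ qs
extremal-injective a {[]} {[]} _ = refl
extremal-injective a {[]} {least ∷ _} ()
extremal-injective a {[]} {greatest ∷ _} ()
extremal-injective a {least ∷ _} {[]} ()
extremal-injective a {greatest ∷ _} {[]} ()
extremal-injective a {least ∷ ps} {least ∷ qs} eq = cong (least ∷_) (extremal-injective (suc a) (∷-injectiveʳ eq))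
extremal-injective a {greatest ∷ ps} {greatest ∷ qs} eq = cong (greatest ∷_) (extremal-injective a (∷-injectiveʳ eq))
extremal-injective a {least ∷ ps} {greatest ∷ qs} eq = ⊥-elim (m≢1+m+n a (∷-injectiveˡ eq))
extremal-injective a {greatest ∷ ps} {least ∷ qs} eq = ⊥-elim (m≢1+m+n a (sym (∷-injectiveˡ eq)))

-- The cyclic permutation with cycle form 1 ∷ extremal 2 ps

-- entry i (counting from 1) is the image of a + i - 1 when extremal a ps is followed by 1
successorTable : ℕ → List Pick → List ℕ
successorTable a [] = [ 1 ]
successorTable a (least ∷ ps) = extremalHead (suc a) ps ∷ successorTable (suc a) ps
successorTable a (greatest ∷ ps) = successorTable a ps ++ [ extremalHead a ps ]

cyclicPerm : List Pick → List ℕ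
cyclicPerm ps = extremalHead 2 ps ∷ successorTable 2 ps

length-successorTable : ∀ a ps → length (successorTable a ps) ≡ suc (length ps)
length-successorTable a [] = refl
length-successorTable a (least ∷ ps) = cong suc (length-successorTable (suc a) ps)
length-successorTable a (greatest ∷ ps) =
  trans (length-++ (successorTable a ps)) (trans (+-comm _ 1) (cong suc (length-successorTable a ps)))

SuccessorEntry : ℕ → List Pick → ℕ → Set
SuccessorEntry a ps v = v ≡ 1 ⊎ (v ∈[ a ⋯ a + length ps ] × v ≢ extremalHead a ps)

successorTable-entries : ∀ a ps → All (SuccessorEntry a ps) (successorTable a ps)
successorTable-entries a [] = inj₁ refl ∷ []
successorTable-entries a (least ∷ ps) =
  inj₂ (extend-down a m (extremalHead-bounded (suc a) ps) , >⇒≢ (proj₁ (extremalHead-bounded (suc a) ps)))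
  ∷ All.map widen (successorTable-entries (suc a) ps)
  where
  m : ℕ
  m = length ps
  widen : ∀ {v} → SuccessorEntry (suc a) ps v → SuccessorEntry a (least ∷ ps) v
  widen (inj₁ v≡1) = inj₁ v≡1
  widen (inj₂ (v∈ , _)) = inj₂ (extend-down a m v∈ , >⇒≢ (proj₁ v∈))
successorTable-entries a (greatest ∷ ps) =
  All.++⁺ (All.map widen (successorTable-entries a ps))
          (inj₂ (extend-up a m (extremalHead-bounded a ps) , <⇒≢ (s≤s (proj₂ (extremalHead-bounded a ps)))) ∷ [])
  where
  m : ℕ
  m = length ps
  widen : ∀ {v} → SuccessorEntry a ps v → SuccessorEntry a (greatest ∷ ps) v
  widen (inj₁ v≡1) = inj₁ v≡1
  widen (inj₂ (v∈ , _)) = inj₂ (extend-up a m v∈ , <⇒≢ (s≤s (proj₂ v∈)))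

extremalHead∉successorTable : ∀ {a} ps → 2 ≤ a → extremalHead a ps ∉ successorTable a ps
extremalHead∉successorTable {a} ps 2≤a h∈ with All.lookup (successorTable-entries a ps) h∈
... | inj₁ h≡1 = <⇒≢ (≤-trans 2≤a (proj₁ (extremalHead-bounded a ps))) (sym h≡1)
... | inj₂ (_ , h≢h) = h≢h refl

Unique-successorTable : ∀ a ps → 2 ≤ a → Unique (successorTable a ps)
Unique-successorTable a [] _ = [] ∷ []
Unique-successorTable a (least ∷ ps) 2≤a =
  ¬Any⇒All¬ _ (extremalHead∉successorTable ps (m≤n⇒m≤1+n 2≤a)) ∷ Unique-successorTable (suc a) ps (m≤n⇒m≤1+n 2≤a)
Unique-successorTable a (greatest ∷ ps) 2≤a =
  Unique.++⁺ (Unique-successorTable a ps 2≤a) ([] ∷ [])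
             λ { (h∈ , here refl) → extremalHead∉successorTable ps 2≤a h∈ }

private
  app-++ˡ : ∀ P Q {k} → k < length P → app (P ++ Q) (suc k) ≡ app P (suc k)
  app-++ˡ (x ∷ P) Q {zero} _ = refl
  app-++ˡ (x ∷ y ∷ P) Q {suc k} (s≤s k<) = app-++ˡ (y ∷ P) Q k<

  app-∷ʳ : ∀ P h → app (P ++ [ h ]) (suc (length P)) ≡ h
  app-∷ʳ [] h = refl
  app-∷ʳ (x ∷ []) h = refl
  app-∷ʳ (x ∷ y ∷ P) h = app-∷ʳ (y ∷ P) h

successor : ℕ → List Pick → ℕ → ℕ
successor a ps x = app (successorTable a ps) (suc (x ∸ a))

extremal-iterates : ∀ a ps → Iterates (successor a ps) (extremal a ps)
extremal-iterates a [] = [-]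
extremal-iterates a (least ∷ ps) =
  subst (λ j → app (successorTable a (least ∷ ps)) (suc j) ≡ extremalHead (suc a) ps) (sym (n∸n≡0 a)) refl
  ∷ iterates-cong (extremal (suc a) ps) shift (extremal-iterates (suc a) ps)
  where
  shift : ∀ {x} → x ∈ extremal (suc a) ps → successor (suc a) ps x ≡ successor a (least ∷ ps) x
  shift x∈ with All.lookup (extremal-bounded (suc a) ps) x∈
  ... | s≤s a≤x , _ rewrite +-∸-assoc 1 a≤x = refl
extremal-iterates a (greatest ∷ ps) = last ∷ iterates-cong (extremal a ps) shift (extremal-iterates a ps)
  where
  m : ℕ
  m = length ps
  table : List ℕ
  table = successorTable a ps
  last : successor a (greatest ∷ ps) (suc (a + m)) ≡ extremalHead a ps
  last rewrite +-∸-assoc 1 (m≤m+n a m) | m+n∸m≡n a m =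
    subst (λ j → app (table ++ [ extremalHead a ps ]) (suc j) ≡ extremalHead a ps) (length-successorTable a ps)
          (app-∷ʳ table (extremalHead a ps))
  shift : ∀ {x} → x ∈ extremal a ps → successor a ps x ≡ successor a (greatest ∷ ps) x
  shift {x} x∈ = sym (app-++ˡ table [ extremalHead a ps ]
    (subst (x ∸ a <_) (sym (length-successorTable a ps))
           (s≤s (subst (x ∸ a ≤_) (m+n∸m≡n a m) (∸-monoˡ-≤ a (proj₂ (All.lookup (extremal-bounded a ps) x∈)))))))

cyclicPerm-iterates : ∀ ps → Iterates (app (cyclicPerm ps)) (1 ∷ extremal 2 ps)
cyclicPerm-iterates ps = refl ∷ iterates-cong (extremal 2 ps) shift (extremal-iterates 2 ps)
  where
  shift : ∀ {x} → x ∈ extremal 2 ps → successor 2 ps x ≡ app (cyclicPerm ps) x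
  shift x∈ with All.lookup (extremal-bounded 2 ps) x∈
  ... | s≤s (s≤s _) , _ = refl

length-cyclicPerm : ∀ ps → length (cyclicPerm ps) ≡ 2 + length ps
length-cyclicPerm ps = cong suc (length-successorTable 2 ps)

cycleForm-cyclicPerm : ∀ ps → cycleForm (cyclicPerm ps) ≡ 1 ∷ extremal 2 ps
cycleForm-cyclicPerm ps =
  trans (cong (λ L → orbit (cyclicPerm ps) L 1) (trans (length-cyclicPerm ps) (cong suc (sym (length-extremal 2 ps)))))
        (iterates⇒orbit (cyclicPerm ps) 1 (extremal 2 ps) (cyclicPerm-iterates ps))

cyclicPerm-isPermutation : ∀ ps → IsPermutation (2 + length ps) (cyclicPerm ps)
cyclicPerm-isPermutation ps =
  length-cyclicPerm ps ,
  head-bounded ∷ All.map entry-bounded (successorTable-entries 2 ps) ,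
  ¬Any⇒All¬ _ (extremalHead∉successorTable ps ≤-refl) ∷ Unique-successorTable 2 ps ≤-refl
  where
  head-bounded : extremalHead 2 ps ∈[ 1 ⋯ 2 + length ps ]
  head-bounded = ≤-trans (s≤s z≤n) (proj₁ (extremalHead-bounded 2 ps)) , proj₂ (extremalHead-bounded 2 ps)
  entry-bounded : ∀ {v} → SuccessorEntry 2 ps v → v ∈[ 1 ⋯ 2 + length ps ]
  entry-bounded (inj₁ refl) = s≤s z≤n , s≤s z≤n
  entry-bounded (inj₂ ((2≤v , v≤) , _)) = ≤-trans (s≤s z≤n) 2≤v , v≤

Avoids213-231 : List ℕ → Set
Avoids213-231 w = ∀ {x y z} → x ∷ y ∷ z ∷ [] ⊆ w → ¬ (y < x × x < z) × ¬ (z < x × x < y)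

Avoids213-231-tail : ∀ {x w} → Avoids213-231 (x ∷ w) → Avoids213-231 w
Avoids213-231-tail avoids s = avoids (_ ∷ʳ s)

extremal-avoids : ∀ a ps → Avoids213-231 (extremal a ps)
extremal-avoids a [] (_ ∷ʳ ())
extremal-avoids a [] (refl ∷ ())
extremal-avoids a (least ∷ ps) (_ ∷ʳ s) = extremal-avoids (suc a) ps s
extremal-avoids a (least ∷ ps) (refl ∷ s) = below (Sublist.lookup s (here refl)) , below (Sublist.lookup s (there (here refl)))
  where
  below : ∀ {v u} → v ∈ extremal (suc a) ps → ¬ (v < a × a < u)
  below v∈ (v<a , _) = <-asym v<a (proj₁ (All.lookup (extremal-bounded (suc a) ps) v∈))
extremal-avoids a (greatest ∷ ps) (_ ∷ʳ s) = extremal-avoids a ps s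
extremal-avoids a (greatest ∷ ps) (refl ∷ s) = above (Sublist.lookup s (there (here refl))) , above (Sublist.lookup s (here refl))
  where
  above : ∀ {v u} → v ∈ extremal a ps → ¬ (u < suc (a + length ps) × suc (a + length ps) < v)
  above v∈ (_ , h<v) = <-asym h<v (s≤s (proj₂ (All.lookup (extremal-bounded a ps) v∈)))

∈-pair-order : ∀ {a b : ℕ} {l} → a ∈ l → b ∈ l → a ≢ b → a ∷ b ∷ [] ⊆ l ⊎ b ∷ a ∷ [] ⊆ l
∈-pair-order (here refl) (here refl) a≢b = ⊥-elim (a≢b refl)
∈-pair-order (here refl) (there b∈) _ = inj₁ (refl ∷ from∈ b∈)
∈-pair-order (there a∈) (here refl) _ = inj₂ (refl ∷ from∈ a∈)
∈-pair-order {l = x ∷ _} (there a∈) (there b∈) a≢b with ∈-pair-order a∈ b∈ a≢b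
... | inj₁ s = inj₁ (x ∷ʳ s)
... | inj₂ s = inj₂ (x ∷ʳ s)

extremal-complete : ∀ m a {w} → Unique w → length w ≡ suc m → All (_∈[ a ⋯ a + m ]) w → Avoids213-231 w →
                    ∃ λ ps → length ps ≡ m × w ≡ extremal a ps
extremal-complete zero a {x ∷ []} _ _ ((a≤x , x≤) ∷ []) _ =
  [] , refl , cong [_] (≤-antisym (subst (x ≤_) (+-identityʳ a) x≤) a≤x)
extremal-complete (suc m) a {x ∷ w} (x∉w ∷ uw) |w| (x∈ ∷ w⊆) avoids with x ≟ a | x ≟ a + suc m
... | yes refl | _ =
  let ps , |ps| , w≡ = extremal-complete m (suc a) uw (suc-injective |w|) (All.zipWith above (x∉w , w⊆))
                                         (Avoids213-231-tail avoids)
  in least ∷ ps , cong suc |ps| , cong (x ∷_) w≡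
  where
  above : ∀ {v} → x ≢ v × v ∈[ a ⋯ a + suc m ] → v ∈[ suc a ⋯ suc a + m ]
  above {v} (x≢v , a≤v , v≤) = ≤∧≢⇒< a≤v x≢v , subst (v ≤_) (+-suc a m) v≤
... | no _ | yes refl =
  let ps , |ps| , w≡ = extremal-complete m a uw (suc-injective |w|) (All.zipWith below (x∉w , w⊆))
                                         (Avoids213-231-tail avoids)
  in greatest ∷ ps , cong suc |ps| , cong₂ _∷_ (trans (+-suc a m) (cong (λ l → suc (a + l)) (sym |ps|))) w≡
  where
  below : ∀ {v} → x ≢ v × v ∈[ a ⋯ a + suc m ] → v ∈[ a ⋯ a + m ]
  below {v} (x≢v , a≤v , v≤) = a≤v , ≤-pred (subst (v <_) (+-suc a m) (≤∧≢⇒< v≤ (x≢v ∘ sym)))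
... | no x≢a | no x≢top =
  ⊥-elim (x-is-extreme (∈-pair-order (in-tail a∈ (x≢a ∘ sym)) (in-tail top∈ (x≢top ∘ sym)) (<⇒≢ a<top)))
  where
  a<x : a < x
  a<x = ≤∧≢⇒< (proj₁ x∈) (x≢a ∘ sym)
  x<top : x < a + suc m
  x<top = ≤∧≢⇒< (proj₂ x∈) x≢top
  a<top : a < a + suc m
  a<top = <-trans a<x x<top
  a∈ : a ∈[ a ⋯ a + suc m ]
  a∈ = ≤-refl , <⇒≤ a<top
  top∈ : a + suc m ∈[ a ⋯ a + suc m ]
  top∈ = <⇒≤ a<top , ≤-refl
  in-tail : ∀ {v} → v ∈[ a ⋯ a + suc m ] → v ≢ x → v ∈ w
  in-tail v∈ v≢x with Unique-fills-interval (x∉w ∷ uw) |w| (x∈ ∷ w⊆) v∈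
  ... | here v≡x = ⊥-elim (v≢x v≡x)
  ... | there v∈w = v∈w
  x-is-extreme : a ∷ a + suc m ∷ [] ⊆ w ⊎ a + suc m ∷ a ∷ [] ⊆ w → ⊥
  x-is-extreme (inj₁ s) = proj₁ (avoids (refl ∷ s)) (a<x , x<top)
  x-is-extreme (inj₂ s) = proj₂ (avoids (refl ∷ s)) (a<x , x<top)

-- Occurrences of 1342 in the rotations of 1 ∷ n ∷ w

∈-subseqs⁻ : ∀ m xs {u} → u ∈ subseqs m xs → u ⊆ xs × length u ≡ m
∈-subseqs⁻ zero xs (here refl) = Sublist.minimum xs , refl
∈-subseqs⁻ (suc m) (x ∷ xs) u∈ with ∈-++⁻ (map (x ∷_) (subseqs m xs)) u∈
... | inj₁ u∈x∷ = let v , v∈ , u≡ = ∈-map⁻ (x ∷_) u∈x∷ ; s , |v| = ∈-subseqs⁻ m xs v∈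
                  in subst (λ u → u ⊆ x ∷ xs × length u ≡ suc m) (sym u≡) (refl ∷ s , cong suc |v|)
... | inj₂ u∈xs = let s , |u| = ∈-subseqs⁻ (suc m) xs u∈xs in x ∷ʳ s , |u|

∈-subseqs⁺ : ∀ {u xs} → u ⊆ xs → u ∈ subseqs (length u) xs
∈-subseqs⁺ [] = here refl
∈-subseqs⁺ {[]} (_ ∷ʳ _) = here refl
∈-subseqs⁺ {_ ∷ u} {y ∷ xs} (_ ∷ʳ s) = ∈-++⁺ʳ (map (y ∷_) (subseqs (length u) xs)) (∈-subseqs⁺ s)
∈-subseqs⁺ (refl ∷ s) = ∈-++⁺ˡ (∈-map⁺ _ (∈-subseqs⁺ s))

containsᵇ⁺ : ∀ {σ u r} → u ⊆ r → length u ≡ length σ → T (orderIsoᵇ u σ) → T (containsᵇ σ r)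
containsᵇ⁺ {σ} {u} {r} s |u| iso = anyᵇ⁺ (λ v → orderIsoᵇ v σ) (subst (λ l → u ∈ subseqs l r) |u| (∈-subseqs⁺ s)) iso

containsᵇ⁻ : ∀ σ r → T (containsᵇ σ r) → ∃ λ u → u ⊆ r × length u ≡ length σ × T (orderIsoᵇ u σ)
containsᵇ⁻ σ r t = let u , u∈ , iso = anyᵇ⁻ (λ v → orderIsoᵇ v σ) (subseqs (length σ) r) t
                       s , |u| = ∈-subseqs⁻ (length σ) r u∈
                   in u , s , |u| , iso

private
  take-length-++ : ∀ (L R : List ℕ) → take (length L) (L ++ R) ≡ L
  take-length-++ [] R = refl
  take-length-++ (x ∷ L) R = cong (x ∷_) (take-length-++ L R)

  drop-length-++ : ∀ (L R : List ℕ) → drop (length L) (L ++ R) ≡ R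
  drop-length-++ [] R = refl
  drop-length-++ (x ∷ L) R = drop-length-++ L R

rotation-∈ : ∀ L y R → y ∷ R ++ L ∈ rotations (L ++ y ∷ R)
rotation-∈ L y R =
  subst (_∈ rotations (L ++ y ∷ R)) (cong₂ _++_ (drop-length-++ L (y ∷ R)) (take-length-++ L (y ∷ R)))
        (∈-map⁺ (λ i → drop i (L ++ y ∷ R) ++ take i (L ++ y ∷ R)) (∈-upTo⁺ |L|<))
  where
  |L|< : length L < length (L ++ y ∷ R)
  |L|< = subst (length L <_) (sym (length-++ L)) (m<m+n (length L) (s≤s z≤n))

∈-rotations⁻ : ∀ c {r} → r ∈ rotations c → ∃₂ λ L R → c ≡ L ++ R × r ≡ R ++ L
∈-rotations⁻ c r∈ with ∈-map⁻ _ r∈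
... | i , _ , refl = take i c , drop i c , sym (take++drop≡id i c) , refl

private
  T-==ᵇtrue : ∀ b → T (b ==ᵇ true) → T b
  T-==ᵇtrue true _ = tt

orderIsoᵇ-∷⁻ : ∀ x u s σ → T (orderIsoᵇ (x ∷ u) (s ∷ σ)) → T (headCompat x u s σ) × T (orderIsoᵇ u σ)
orderIsoᵇ-∷⁻ x u s σ = Equivalence.to (T-∧ {headCompat x u s σ})

headCompat⁻ : ∀ x u s σ → T (headCompat x u s σ) →
              Pointwise (λ y t → T ((x <ᵇ y) ==ᵇ (s <ᵇ t)) × T ((y <ᵇ x) ==ᵇ (t <ᵇ s))) u σ
headCompat⁻ x [] s [] _ = []
headCompat⁻ x (y ∷ u) s (t ∷ σ) h =
  let x-vs-y , h′ = Equivalence.to (T-∧ {(x <ᵇ y) ==ᵇ (s <ᵇ t)}) h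
      y-vs-x , h″ = Equivalence.to (T-∧ {(y <ᵇ x) ==ᵇ (t <ᵇ s)}) h′
  in (x-vs-y , y-vs-x) ∷ headCompat⁻ x u s σ h″

iso1342⁻ : ∀ a b c d → T (orderIsoᵇ (a ∷ b ∷ c ∷ d ∷ []) p1342) → a < d × d < b × b < c
iso1342⁻ a b c d iso
  with compare-a , iso′ ← orderIsoᵇ-∷⁻ a (b ∷ c ∷ d ∷ []) 1 (3 ∷ 4 ∷ 2 ∷ []) iso
  with compare-b , _ ← orderIsoᵇ-∷⁻ b (c ∷ d ∷ []) 3 (4 ∷ 2 ∷ []) iso′
  with _ ∷ _ ∷ (a<d , _) ∷ [] ← headCompat⁻ a (b ∷ c ∷ d ∷ []) 1 (3 ∷ 4 ∷ 2 ∷ []) compare-a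
  with (b<c , _) ∷ (_ , d<b) ∷ [] ← headCompat⁻ b (c ∷ d ∷ []) 3 (4 ∷ 2 ∷ []) compare-b
  = <ᵇ⇒< a d (T-==ᵇtrue _ a<d) , <ᵇ⇒< d b (T-==ᵇtrue _ d<b) , <ᵇ⇒< b c (T-==ᵇtrue _ b<c)

iso1342⁺ : ∀ {a b c d} → a < d → d < b → b < c → T (orderIsoᵇ (a ∷ b ∷ c ∷ d ∷ []) p1342)
iso1342⁺ a<d d<b b<c = ordered (<-trans a<d d<b) (<-trans (<-trans a<d d<b) b<c) a<d b<c d<b (<-trans d<b b<c)
  where
  ordered : ∀ {a b c d} → a < b → a < c → a < d → b < c → d < b → d < c → T (orderIsoᵇ (a ∷ b ∷ c ∷ d ∷ []) p1342)
  ordered a<b a<c a<d b<c d<b d<c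
    rewrite <ᵇ-true a<b | <ᵇ-false (<⇒≤ a<b) | <ᵇ-true a<c | <ᵇ-false (<⇒≤ a<c) | <ᵇ-true a<d | <ᵇ-false (<⇒≤ a<d)
          | <ᵇ-true b<c | <ᵇ-false (<⇒≤ b<c) | <ᵇ-true d<b | <ᵇ-false (<⇒≤ d<b)
          | <ᵇ-true d<c | <ᵇ-false (<⇒≤ d<c) = tt

⊆-∷-split : ∀ {x : ℕ} {u w} → x ∷ u ⊆ w → ∃₂ λ w₁ w₂ → w ≡ w₁ ++ x ∷ w₂ × u ⊆ w₂
⊆-∷-split (y ∷ʳ s) = let w₁ , w₂ , w≡ , s′ = ⊆-∷-split s in y ∷ w₁ , w₂ , cong (y ∷_) w≡ , s′
⊆-∷-split {w = _ ∷ w} (refl ∷ s) = [] , w , refl , s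

RotationsAvoid1342 : List ℕ → Set
RotationsAvoid1342 c = T (allᵇ (avoidsᵇ p1342) (rotations c))

rotations-avoid⇒Avoids213-231 : ∀ {k} w → All (_∈[ 2 ⋯ k ]) w → RotationsAvoid1342 (1 ∷ suc k ∷ w) → Avoids213-231 w
rotations-avoid⇒Avoids213-231 {k} w w⊆ rotAvoid {x} {y} {z} s = no213 , no231
  where
  c : List ℕ
  c = 1 ∷ suc k ∷ w
  avoids : ∀ {r u} → r ∈ rotations c → u ⊆ r → length u ≡ 4 → ¬ T (orderIsoᵇ u p1342)
  avoids r∈ s′ |u| iso = T-not⁻ (allᵇ⁻ (avoidsᵇ p1342) (rotations c) rotAvoid r∈) (containsᵇ⁺ s′ |u| iso)
  z<top : z < suc k
  z<top = s≤s (proj₂ (All.lookup w⊆ (Sublist.lookup s (there (there (here refl))))))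
  -- y z (suc k) x is a 1342 in the rotation starting at y
  no213 : ¬ (y < x × x < z)
  no213 (y<x , x<z) with ⊆-∷-split s
  ... | w₁ , w₂ , refl , s₂ with ⊆-∷-split s₂
  ... | w₃ , w₄ , refl , s₄ = avoids r∈ sub refl (iso1342⁺ y<x x<z z<top)
    where
    L : List ℕ
    L = 1 ∷ suc k ∷ w₁ ++ x ∷ w₃
    r∈ : y ∷ w₄ ++ L ∈ rotations c
    r∈ = subst (λ l → y ∷ w₄ ++ L ∈ rotations (1 ∷ suc k ∷ l)) (++-assoc w₁ (x ∷ w₃) (y ∷ w₄)) (rotation-∈ L y w₄)
    sub : y ∷ z ∷ suc k ∷ x ∷ [] ⊆ y ∷ w₄ ++ L
    sub = Sublist.++⁺ {as = y ∷ z ∷ []} (refl ∷ s₄) (1 ∷ʳ refl ∷ from∈ (∈-++⁺ʳ w₁ (here refl)))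
  -- 1 x y z is a 1342 in c itself
  no231 : ¬ (z < x × x < y)
  no231 (z<x , x<y) = avoids c∈ (refl ∷ suc k ∷ʳ s) refl (iso1342⁺ 1<z z<x x<y)
    where
    c∈ : c ∈ rotations c
    c∈ = subst (_∈ rotations c) (cong (λ l → 1 ∷ suc k ∷ l) (++-identityʳ w)) (rotation-∈ [] 1 (suc k ∷ w))
    1<z : 1 < z
    1<z = proj₁ (All.lookup w⊆ (Sublist.lookup s (there (there (here refl)))))

private
  rotations-of-4 : ∀ (u₁ u₂ : List ℕ) {a b c d} → u₁ ++ u₂ ≡ a ∷ b ∷ c ∷ d ∷ [] →
                   u₂ ++ u₁ ≡ a ∷ b ∷ c ∷ d ∷ [] ⊎ u₂ ++ u₁ ≡ b ∷ c ∷ d ∷ a ∷ [] ⊎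
                   u₂ ++ u₁ ≡ c ∷ d ∷ a ∷ b ∷ [] ⊎ u₂ ++ u₁ ≡ d ∷ a ∷ b ∷ c ∷ []
  rotations-of-4 [] u₂ refl = inj₁ (++-identityʳ u₂)
  rotations-of-4 (_ ∷ []) _ refl = inj₂ (inj₁ refl)
  rotations-of-4 (_ ∷ _ ∷ []) _ refl = inj₂ (inj₂ (inj₁ refl))
  rotations-of-4 (_ ∷ _ ∷ _ ∷ []) _ refl = inj₂ (inj₂ (inj₂ refl))
  rotations-of-4 (_ ∷ _ ∷ _ ∷ _ ∷ []) [] refl = inj₁ refl

  ⊆-++-split : ∀ {u} (b d : List ℕ) → u ⊆ b ++ d → ∃₂ λ u₁ u₂ → u ≡ u₁ ++ u₂ × u₁ ⊆ b × u₂ ⊆ d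
  ⊆-++-split [] d s = [] , _ , refl , [] , s
  ⊆-++-split (y ∷ b) d (_ ∷ʳ s) =
    let u₁ , u₂ , u≡ , s₁ , s₂ = ⊆-++-split b d s in u₁ , u₂ , u≡ , y ∷ʳ s₁ , s₂
  ⊆-++-split (y ∷ b) d (refl ∷ s) =
    let u₁ , u₂ , u≡ , s₁ , s₂ = ⊆-++-split b d s in y ∷ u₁ , u₂ , cong (y ∷_) u≡ , refl ∷ s₁ , s₂

  data Placement (n : ℕ) (w : List ℕ) (e₁ e₂ e₃ e₄ : ℕ) : Set where
    in-w   : e₁ ∷ e₂ ∷ e₃ ∷ e₄ ∷ [] ⊆ w → Placement n w e₁ e₂ e₃ e₄
    at-1   : e₁ ≡ 1 → e₂ ∷ e₃ ∷ e₄ ∷ [] ⊆ w → Placement n w e₁ e₂ e₃ e₄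
    at-1-n : e₁ ≡ 1 → e₂ ≡ n → e₃ ∷ e₄ ∷ [] ⊆ w → Placement n w e₁ e₂ e₃ e₄
    at-n   : e₁ ≡ n → e₂ ∷ e₃ ∷ e₄ ∷ [] ⊆ w → Placement n w e₁ e₂ e₃ e₄

  placement : ∀ {n w e₁ e₂ e₃ e₄} → e₁ ∷ e₂ ∷ e₃ ∷ e₄ ∷ [] ⊆ 1 ∷ n ∷ w → Placement n w e₁ e₂ e₃ e₄
  placement (_ ∷ʳ _ ∷ʳ s) = in-w s
  placement (_ ∷ʳ refl ∷ s) = at-n refl s
  placement (refl ∷ _ ∷ʳ s) = at-1 refl s
  placement (refl ∷ refl ∷ s) = at-1-n refl refl s

  first-three : ∀ {e₁ e₂ e₃ e₄ : ℕ} {w} → e₁ ∷ e₂ ∷ e₃ ∷ e₄ ∷ [] ⊆ w → e₁ ∷ e₂ ∷ e₃ ∷ [] ⊆ w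
  first-three = Sublist.⊆-trans (refl ∷ refl ∷ refl ∷ _ ∷ʳ [])

  last-three : ∀ {e₁ e₂ e₃ e₄ : ℕ} {w} → e₁ ∷ e₂ ∷ e₃ ∷ e₄ ∷ [] ⊆ w → e₂ ∷ e₃ ∷ e₄ ∷ [] ⊆ w
  last-three = Sublist.⊆-trans (_ ∷ʳ Sublist.⊆-refl)

-- a b c d is order-isomorphic to 1342
module No1342 {k : ℕ} {w : List ℕ} (w⊆ : All (_∈[ 2 ⋯ k ]) w) (avoids : Avoids213-231 w)
              {a b c d : ℕ} (a<d : a < d) (d<b : d < b) (b<c : b < c) where

  private
    bounds : ∀ {v u} → v ∈ u → u ⊆ w → v ∈[ 2 ⋯ k ]
    bounds v∈ s = All.lookup w⊆ (Sublist.lookup s v∈)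

  no-abcd : ¬ (a ∷ b ∷ c ∷ d ∷ [] ⊆ 1 ∷ suc k ∷ w)
  no-abcd s with placement s
  ... | in-w s′ = proj₂ (avoids (last-three s′)) (d<b , b<c)
  ... | at-1 _ s′ = proj₂ (avoids s′) (d<b , b<c)
  ... | at-1-n _ refl s′ = <-asym b<c (s≤s (proj₂ (bounds (here refl) s′)))
  ... | at-n _ s′ = proj₂ (avoids s′) (d<b , b<c)

  no-bcda : ¬ (b ∷ c ∷ d ∷ a ∷ [] ⊆ 1 ∷ suc k ∷ w)
  no-bcda s with placement s
  ... | in-w s′ = proj₂ (avoids (first-three s′)) (d<b , b<c)
  ... | at-1 refl s′ = <-asym (<-trans a<d d<b) (proj₁ (bounds (there (there (here refl))) s′))
  ... | at-1-n refl _ s′ = <-asym (<-trans a<d d<b) (proj₁ (bounds (there (here refl)) s′))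
  ... | at-n refl s′ = <-asym b<c (s≤s (proj₂ (bounds (here refl) s′)))

  no-cdab : ¬ (c ∷ d ∷ a ∷ b ∷ [] ⊆ 1 ∷ suc k ∷ w)
  no-cdab s with placement s
  ... | in-w s′ = proj₁ (avoids (last-three s′)) (a<d , d<b)
  ... | at-1 refl s′ = <-asym (<-trans d<b b<c) (proj₁ (bounds (here refl) s′))
  ... | at-1-n _ refl s′ = <-asym d<b (s≤s (proj₂ (bounds (there (here refl)) s′)))
  ... | at-n _ s′ = proj₁ (avoids s′) (a<d , d<b)

  no-dabc : ¬ (d ∷ a ∷ b ∷ c ∷ [] ⊆ 1 ∷ suc k ∷ w)
  no-dabc s with placement s
  ... | in-w s′ = proj₁ (avoids (first-three s′)) (a<d , d<b)
  ... | at-1 refl s′ = <-asym a<d (proj₁ (bounds (here refl) s′))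
  ... | at-1-n refl refl s′ = <-asym (<-trans a<d d<b) (s≤s (proj₂ (bounds (here refl) s′)))
  ... | at-n refl s′ = <-asym d<b (s≤s (proj₂ (bounds (there (here refl)) s′)))

Avoids213-231⇒rotations-avoid : ∀ {k} w → All (_∈[ 2 ⋯ k ]) w → Avoids213-231 w → RotationsAvoid1342 (1 ∷ suc k ∷ w)
Avoids213-231⇒rotations-avoid {k} w w⊆ avoids = allᵇ⁺ (avoidsᵇ p1342) (rotations c) (T-not⁺ ∘ no-occurrence)
  where
  c : List ℕ
  c = 1 ∷ suc k ∷ w
  no-occurrence : ∀ {r} → r ∈ rotations c → ¬ T (containsᵇ p1342 r)
  no-occurrence {r} r∈ t with containsᵇ⁻ p1342 r t | ∈-rotations⁻ c r∈
  ... | a ∷ b ∷ c′ ∷ d ∷ [] , s , _ , iso | L , R , c≡ , refl with ⊆-++-split R L s | iso1342⁻ a b c′ d iso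
  -- split at the rotation point, the occurrence becomes a rotation of a b c′ d lying in c
  ...   | u₁ , u₂ , u≡ , s₁ , s₂ | a<d , d<b , b<c′ = rotated (rotations-of-4 u₁ u₂ (sym u≡))
    where
    open No1342 w⊆ avoids a<d d<b b<c′
    in-c : u₂ ++ u₁ ⊆ c
    in-c = subst (u₂ ++ u₁ ⊆_) (sym c≡) (Sublist.++⁺ s₂ s₁)
    rotated : u₂ ++ u₁ ≡ a ∷ b ∷ c′ ∷ d ∷ [] ⊎ u₂ ++ u₁ ≡ b ∷ c′ ∷ d ∷ a ∷ [] ⊎
              u₂ ++ u₁ ≡ c′ ∷ d ∷ a ∷ b ∷ [] ⊎ u₂ ++ u₁ ≡ d ∷ a ∷ b ∷ c′ ∷ [] → ⊥
    rotated (inj₁ e) = no-abcd (subst (_⊆ c) e in-c)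
    rotated (inj₂ (inj₁ e)) = no-bcda (subst (_⊆ c) e in-c)
    rotated (inj₂ (inj₂ (inj₁ e))) = no-cdab (subst (_⊆ c) e in-c)
    rotated (inj₂ (inj₂ (inj₂ e))) = no-dabc (subst (_⊆ c) e in-c)

-- Longest decreasing subsequences

betweenᵇ : ℕ → ℕ → ℕ → Bool
betweenᵇ lo hi x = (lo <ᵇ x) ∧ (x <ᵇ hi)

withHead : Bool → ℕ → ℕ → ℕ
withHead usable a b = if usable then suc a ⊔ b else b

withLast : Bool → ℕ → ℕ → ℕ
withLast usable a b = if usable then a ⊔ suc b else a

-- length of a longest decreasing subsequence of xs with entries strictly between lo and hi
lds : ℕ → ℕ → List ℕ → ℕ
lds lo hi [] = 0
lds lo hi (x ∷ xs) = withHead (betweenᵇ lo hi x) (lds lo x xs) (lds lo hi xs)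

lds-cong-hi : ∀ lo h₁ h₂ xs → (∀ {y} → y ∈ xs → (y <ᵇ h₁) ≡ (y <ᵇ h₂)) → lds lo h₁ xs ≡ lds lo h₂ xs
lds-cong-hi lo h₁ h₂ [] _ = refl
lds-cong-hi lo h₁ h₂ (x ∷ xs) same
  rewrite same (here refl) | lds-cong-hi lo h₁ h₂ xs (same ∘ there) = refl

lds-cong-lo : ∀ l₁ l₂ hi xs → (∀ {y} → y ∈ xs → (l₁ <ᵇ y) ≡ (l₂ <ᵇ y)) → lds l₁ hi xs ≡ lds l₂ hi xs
lds-cong-lo l₁ l₂ hi [] _ = refl
lds-cong-lo l₁ l₂ hi (x ∷ xs) same
  rewrite same (here refl) | lds-cong-lo l₁ l₂ x xs (same ∘ there) | lds-cong-lo l₁ l₂ hi xs (same ∘ there) = refl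

lds-outside : ∀ lo hi xs → (∀ {y} → y ∈ xs → betweenᵇ lo hi y ≡ false) → lds lo hi xs ≡ 0
lds-outside lo hi [] _ = refl
lds-outside lo hi (x ∷ xs) outside rewrite outside (here refl) = lds-outside lo hi xs (outside ∘ there)

betweenᵇ-true : ∀ {lo hi x} → lo < x → x < hi → betweenᵇ lo hi x ≡ true
betweenᵇ-true lo<x x<hi rewrite <ᵇ-true lo<x | <ᵇ-true x<hi = refl

betweenᵇ-true⁻ : ∀ lo hi x → betweenᵇ lo hi x ≡ true → lo < x × x < hi
betweenᵇ-true⁻ lo hi x eq with Equivalence.to (T-∧ {lo <ᵇ x}) (Equivalence.from T-≡ eq)
... | lo<x , x<hi = <ᵇ⇒< lo x lo<x , <ᵇ⇒< x hi x<hi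

betweenᵇ-false : ∀ lo hi x → x ≤ lo ⊎ hi ≤ x → betweenᵇ lo hi x ≡ false
betweenᵇ-false lo hi x (inj₁ x≤lo) rewrite <ᵇ-false {lo} x≤lo = refl
betweenᵇ-false lo hi x (inj₂ hi≤x) rewrite <ᵇ-false {x} hi≤x = ∧-zeroʳ (lo <ᵇ x)

betweenᵇ-false⁻ : ∀ lo hi x → betweenᵇ lo hi x ≡ false → x ≤ lo ⊎ hi ≤ x
betweenᵇ-false⁻ lo hi x eq with lo <? x | x <? hi
... | yes lo<x | yes x<hi = ⊥-elim (subst T (trans (sym (betweenᵇ-true lo<x x<hi)) eq) tt)
... | no lo≮x | _ = inj₁ (≮⇒≥ lo≮x)
... | yes _ | no x≮hi = inj₂ (≮⇒≥ x≮hi)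

private
  withHead-withLast : ∀ cx cyx cy cy′ a b c d →
    (cx ≡ true → cy′ ≡ true → cy ≡ true × cyx ≡ true) →
    (cx ≡ true → cy′ ≡ false → cy ≡ true → cyx ≡ false) →
    (cx ≡ false → cy ≡ true → cyx ≡ false) →
    withHead cx (withLast cy′ a b) (withLast cy c d) ≡ withLast cy (withHead cx a c) (withHead cyx b d)
  withHead-withLast true _ _ true a b c d both _ _ with both refl refl
  ... | refl , refl = ⊔-interchange (suc a) (suc (suc b)) c (suc d)
  withHead-withLast true _ true false a b c d _ mixed _ with mixed refl refl refl
  ... | refl = sym (⊔-assoc (suc a) c (suc d))
  withHead-withLast true _ false false a b c d _ _ _ = refl
  withHead-withLast false _ true _ a b c d _ _ neither with neither refl refl
  ... | refl = refl
  withHead-withLast false _ false _ a b c d _ _ _ = refl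

-- the last entry y ends a decreasing subsequence whose other entries lie between y and hi
lds-∷ʳ : ∀ lo hi xs y → lds lo hi (xs ++ [ y ]) ≡ withLast (betweenᵇ lo hi y) (lds lo hi xs) (lds y hi xs)
lds-∷ʳ lo hi [] y with betweenᵇ lo hi y
... | true = refl
... | false = refl
lds-∷ʳ lo hi (x ∷ xs) y =
  trans (cong₂ (withHead (betweenᵇ lo hi x)) (lds-∷ʳ lo x xs y) (lds-∷ʳ lo hi xs y))
        (withHead-withLast (betweenᵇ lo hi x) (betweenᵇ y hi x) (betweenᵇ lo hi y) (betweenᵇ lo x y)
                           (lds lo x xs) (lds y x xs) (lds lo hi xs) (lds y hi xs) both mixed neither)
  where
  both : betweenᵇ lo hi x ≡ true → betweenᵇ lo x y ≡ true → betweenᵇ lo hi y ≡ true × betweenᵇ y hi x ≡ true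
  both x∈ y∈ = let lo<x , x<hi = betweenᵇ-true⁻ lo hi x x∈ ; lo<y , y<x = betweenᵇ-true⁻ lo x y y∈
               in betweenᵇ-true lo<y (<-trans y<x x<hi) , betweenᵇ-true y<x x<hi
  mixed : betweenᵇ lo hi x ≡ true → betweenᵇ lo x y ≡ false → betweenᵇ lo hi y ≡ true → betweenᵇ y hi x ≡ false
  mixed x∈ y∉ y∈ with betweenᵇ-false⁻ lo x y y∉
  ... | inj₁ y≤lo = ⊥-elim (<⇒≱ (proj₁ (betweenᵇ-true⁻ lo hi y y∈)) y≤lo)
  ... | inj₂ x≤y = betweenᵇ-false y hi x (inj₁ x≤y)
  neither : betweenᵇ lo hi x ≡ false → betweenᵇ lo hi y ≡ true → betweenᵇ y hi x ≡ false
  neither x∉ y∈ with betweenᵇ-false⁻ lo hi x x∉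
  ... | inj₁ x≤lo = betweenᵇ-false y hi x (inj₁ (≤-trans x≤lo (<⇒≤ (proj₁ (betweenᵇ-true⁻ lo hi y y∈)))))
  ... | inj₂ hi≤x = betweenᵇ-false y hi x (inj₂ hi≤x)

private
  anyᵇ-++ : ∀ (p : A → Bool) xs ys → anyᵇ p (xs ++ ys) ≡ anyᵇ p xs ∨ anyᵇ p ys
  anyᵇ-++ p [] ys = refl
  anyᵇ-++ p (x ∷ xs) ys = trans (cong (p x ∨_) (anyᵇ-++ p xs ys)) (sym (∨-assoc (p x) _ _))

  anyᵇ-map : ∀ {B : Set} (p : B → Bool) (f : A → B) xs → anyᵇ p (map f xs) ≡ anyᵇ (p ∘ f) xs
  anyᵇ-map p f [] = refl
  anyᵇ-map p f (x ∷ xs) = cong (p (f x) ∨_) (anyᵇ-map p f xs)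

  anyᵇ-cong : ∀ (p q : A → Bool) xs → (∀ {x} → x ∈ xs → p x ≡ q x) → anyᵇ p xs ≡ anyᵇ q xs
  anyᵇ-cong p q [] _ = refl
  anyᵇ-cong p q (x ∷ xs) p≗q = cong₂ _∨_ (p≗q (here refl)) (anyᵇ-cong p q xs (p≗q ∘ there))

  anyᵇ-∧ˡ : ∀ c (p : A → Bool) xs → anyᵇ (λ x → c ∧ p x) xs ≡ c ∧ anyᵇ p xs
  anyᵇ-∧ˡ c p [] = sym (∧-zeroʳ c)
  anyᵇ-∧ˡ c p (x ∷ xs) = trans (cong ((c ∧ p x) ∨_) (anyᵇ-∧ˡ c p xs)) (sym (∧-distribˡ-∨ c (p x) _))

  ≤ᵇ-suc : ∀ k n → (suc k ≤ᵇ suc n) ≡ (k ≤ᵇ n)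
  ≤ᵇ-suc zero n = refl
  ≤ᵇ-suc (suc k) n = refl

  ≤ᵇ-⊔ : ∀ k a b → (k ≤ᵇ a ⊔ b) ≡ (k ≤ᵇ a) ∨ (k ≤ᵇ b)
  ≤ᵇ-⊔ zero a b = refl
  ≤ᵇ-⊔ (suc k) zero b = refl
  ≤ᵇ-⊔ (suc k) (suc a) zero = sym (∨-identityʳ _)
  ≤ᵇ-⊔ (suc k) (suc a) (suc b) =
    trans (≤ᵇ-suc k (a ⊔ b)) (trans (≤ᵇ-⊔ k a b) (sym (cong₂ _∨_ (≤ᵇ-suc k a) (≤ᵇ-suc k b))))

  ≤ᵇ-withHead : ∀ k c a b → (suc k ≤ᵇ withHead c a b) ≡ (c ∧ (k ≤ᵇ a)) ∨ (suc k ≤ᵇ b)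
  ≤ᵇ-withHead k true a b = trans (≤ᵇ-⊔ (suc k) (suc a) b) (cong (_∨ (suc k ≤ᵇ b)) (≤ᵇ-suc k a))
  ≤ᵇ-withHead k false a b = refl

length-δ : ∀ k → length (δ k) ≡ k
length-δ k = trans (length-map suc (downFrom k)) (length-downFrom k)

δ-bounded : ∀ k → All (_< suc k) (δ k)
δ-bounded zero = []
δ-bounded (suc k) = ≤-refl ∷ All.map m<n⇒m<1+n (δ-bounded k)

-- against a pattern whose later entries are all smaller, x compares like a maximum
headCompat-below : ∀ x u s σ → length u ≡ length σ → All (_< s) σ → headCompat x u s σ ≡ allᵇ (_<ᵇ x) u
headCompat-below x [] s [] _ _ = refl
headCompat-below x (y ∷ u) s (t ∷ σ) |u| (t<s ∷ σ<s)
  rewrite <ᵇ-false (<⇒≤ t<s) | <ᵇ-true t<s | headCompat-below x u s σ (suc-injective |u|) σ<s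
  with y <ᵇ x in y<x | x <ᵇ y in x<y
... | true | true = ⊥-elim (<-asym (<ᵇ⇒< y x (subst T (sym y<x) tt)) (<ᵇ⇒< x y (subst T (sym x<y) tt)))
... | true | false = refl
... | false | true = refl
... | false | false = refl

private
  ∧-redundant : ∀ a b c d → (a ≡ true → c ≡ true → b ≡ true) → (a ∧ b) ∧ (c ∧ d) ≡ a ∧ (c ∧ d)
  ∧-redundant true b true d b-follows rewrite b-follows refl refl = refl
  ∧-redundant true true false d _ = refl
  ∧-redundant true false false d _ = refl
  ∧-redundant false b c d _ = refl

  allᵇ-<ᵇ-trans : ∀ u {x hi} → x < hi → allᵇ (_<ᵇ x) u ≡ true → allᵇ (_<ᵇ hi) u ≡ true
  allᵇ-<ᵇ-trans u {x} {hi} x<hi u<x = Equivalence.to T-≡ (allᵇ⁺ (_<ᵇ hi) u λ {v} v∈ →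
    <⇒<ᵇ (<-trans (<ᵇ⇒< v x (allᵇ⁻ (_<ᵇ x) u (Equivalence.from T-≡ u<x) v∈)) x<hi))

DecreasingBelow : ℕ → ℕ → List ℕ → Bool
DecreasingBelow hi k u = allᵇ (_<ᵇ hi) u ∧ orderIsoᵇ u (δ k)

decreasing-below : ∀ k xs hi → All (0 <_) xs → anyᵇ (DecreasingBelow hi k) (subseqs k xs) ≡ (k ≤ᵇ lds 0 hi xs)
decreasing-below zero xs hi _ = refl
decreasing-below (suc k) [] hi _ = refl
decreasing-below (suc k) (x@(suc _) ∷ xs) hi (_ ∷ xs>0) = begin
  anyᵇ (DecreasingBelow hi (suc k)) (map (x ∷_) (subseqs k xs) ++ subseqs (suc k) xs)
    ≡⟨ anyᵇ-++ (DecreasingBelow hi (suc k)) (map (x ∷_) (subseqs k xs)) _ ⟩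
  anyᵇ (DecreasingBelow hi (suc k)) (map (x ∷_) (subseqs k xs)) ∨ anyᵇ (DecreasingBelow hi (suc k)) (subseqs (suc k) xs)
    ≡⟨ cong₂ _∨_ starting-with-x (decreasing-below (suc k) xs hi xs>0) ⟩
  ((x <ᵇ hi) ∧ (k ≤ᵇ lds 0 x xs)) ∨ (suc k ≤ᵇ lds 0 hi xs)
    ≡⟨ sym (≤ᵇ-withHead k (x <ᵇ hi) (lds 0 x xs) (lds 0 hi xs)) ⟩
  suc k ≤ᵇ lds 0 hi (x ∷ xs)
    ∎
  where
  open ≡-Reasoning
  prepend-x : ∀ {u} → u ∈ subseqs k xs → DecreasingBelow hi (suc k) (x ∷ u) ≡ (x <ᵇ hi) ∧ DecreasingBelow x k u
  prepend-x {u} u∈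
    rewrite headCompat-below x u (suc k) (δ k) (trans (proj₂ (∈-subseqs⁻ k xs u∈)) (sym (length-δ k))) (δ-bounded k) =
    ∧-redundant (x <ᵇ hi) (allᵇ (_<ᵇ hi) u) (allᵇ (_<ᵇ x) u) (orderIsoᵇ u (δ k))
                (λ x<hi u<x → allᵇ-<ᵇ-trans u (<ᵇ⇒< x hi (Equivalence.from T-≡ x<hi)) u<x)
  starting-with-x : anyᵇ (DecreasingBelow hi (suc k)) (map (x ∷_) (subseqs k xs)) ≡ (x <ᵇ hi) ∧ (k ≤ᵇ lds 0 x xs)
  starting-with-x = begin
    anyᵇ (DecreasingBelow hi (suc k)) (map (x ∷_) (subseqs k xs))
      ≡⟨ anyᵇ-map (DecreasingBelow hi (suc k)) (x ∷_) (subseqs k xs) ⟩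
    anyᵇ (λ u → DecreasingBelow hi (suc k) (x ∷ u)) (subseqs k xs)
      ≡⟨ anyᵇ-cong _ (λ u → (x <ᵇ hi) ∧ DecreasingBelow x k u) (subseqs k xs) prepend-x ⟩
    anyᵇ (λ u → (x <ᵇ hi) ∧ DecreasingBelow x k u) (subseqs k xs)
      ≡⟨ anyᵇ-∧ˡ (x <ᵇ hi) (DecreasingBelow x k) (subseqs k xs) ⟩
    (x <ᵇ hi) ∧ anyᵇ (DecreasingBelow x k) (subseqs k xs)
      ≡⟨ cong ((x <ᵇ hi) ∧_) (decreasing-below k xs x xs>0) ⟩
    (x <ᵇ hi) ∧ (k ≤ᵇ lds 0 x xs)
      ∎

containsᵇ-δ : ∀ k π H → All (0 <_) π → All (_< H) π → containsᵇ (δ k) π ≡ (k ≤ᵇ lds 0 H π)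
containsᵇ-δ k π H π>0 π<H rewrite length-δ k =
  trans (anyᵇ-cong (λ u → orderIsoᵇ u (δ k)) (DecreasingBelow H k) (subseqs k π) below-H) (decreasing-below k π H π>0)
  where
  below-H : ∀ {u} → u ∈ subseqs k π → orderIsoᵇ u (δ k) ≡ DecreasingBelow H k u
  below-H {u} u∈ rewrite Equivalence.to T-≡ (allᵇ⁺ (_<ᵇ H) u λ v∈ →
    <⇒<ᵇ (All.lookup π<H (Sublist.lookup (proj₁ (∈-subseqs⁻ k π u∈)) v∈))) = refl

avoidsᵇ-δ : ∀ k π H → All (0 <_) π → All (_< H) π → avoidsᵇ (δ k) π ≡ (lds 0 H π <ᵇ k)
avoidsᵇ-δ k π H π>0 π<H = trans (cong not (containsᵇ-δ k π H π>0 π<H)) (not-≤ᵇ k (lds 0 H π))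
  where
  not-≤ᵇ : ∀ k n → not (k ≤ᵇ n) ≡ (n <ᵇ k)
  not-≤ᵇ zero n = refl
  not-≤ᵇ (suc zero) zero = refl
  not-≤ᵇ (suc zero) (suc n) = refl
  not-≤ᵇ (suc (suc k)) zero = refl
  not-≤ᵇ (suc (suc k)) (suc n) = trans (cong not (≤ᵇ-suc (suc k) n)) (not-≤ᵇ (suc k) n)

-- The longest decreasing subsequence of a successor table

changes : Pick → List Pick → ℕ
changes p [] = 0
changes least (least ∷ ps) = changes least ps
changes least (greatest ∷ ps) = suc (changes greatest ps)
changes greatest (greatest ∷ ps) = changes greatest ps
changes greatest (least ∷ ps) = suc (changes least ps)

runs : List Pick → ℕ
runs [] = 0
runs (p ∷ ps) = suc (changes p ps)

allLeast : List Pick → ℕ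
allLeast [] = 1
allLeast (least ∷ ps) = allLeast ps
allLeast (greatest ∷ ps) = 0

lds-∷-inside : ∀ {l H h} P → l < h → h < H → lds l H (h ∷ P) ≡ suc (lds l h P) ⊔ lds l H P
lds-∷-inside {l} {H} {h} P l<h h<H = cong (λ c → withHead c (lds l h P) (lds l H P)) (betweenᵇ-true l<h h<H)

lds-∷ʳ-inside : ∀ {l H h} P → l < h → h < H → lds l H (P ++ [ h ]) ≡ lds l H P ⊔ suc (lds h H P)
lds-∷ʳ-inside {l} {H} {h} P l<h h<H =
  trans (lds-∷ʳ l H P h) (cong (λ c → withLast c (lds l H P) (lds h H P)) (betweenᵇ-true l<h h<H))

module _ {a : ℕ} {ps : List Pick} where

  private
    entry : ∀ {y} → y ∈ successorTable a ps → SuccessorEntry a ps y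
    entry = All.lookup (successorTable-entries a ps)

  successorTable-< : ∀ {H} → 1 ≤ a → a + length ps < H → ∀ {y} → y ∈ successorTable a ps → y < H
  successorTable-< 1≤a a+m<H y∈ with entry y∈
  ... | inj₁ refl = ≤-<-trans (≤-trans 1≤a (m≤m+n _ _)) a+m<H
  ... | inj₂ ((_ , y≤) , _) = ≤-<-trans y≤ a+m<H

  lds-successorTable-below : ∀ {lo hi} → 1 ≤ lo → hi ≤ a → lds lo hi (successorTable a ps) ≡ 0
  lds-successorTable-below {lo} {hi} 1≤lo hi≤a =
    lds-outside lo hi (successorTable a ps) λ y∈ → betweenᵇ-false lo hi _ (outside (entry y∈))
    where
    outside : ∀ {y} → SuccessorEntry a ps y → y ≤ lo ⊎ hi ≤ y
    outside (inj₁ refl) = inj₁ 1≤lo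
    outside (inj₂ ((a≤y , _) , _)) = inj₂ (≤-trans hi≤a a≤y)

  lds-successorTable-above : ∀ {lo hi} → 1 ≤ lo → a + length ps ≤ lo → lds lo hi (successorTable a ps) ≡ 0
  lds-successorTable-above {lo} {hi} 1≤lo top≤lo =
    lds-outside lo hi (successorTable a ps) λ y∈ → betweenᵇ-false lo hi _ (inj₁ (outside (entry y∈)))
    where
    outside : ∀ {y} → SuccessorEntry a ps y → y ≤ lo
    outside (inj₁ refl) = 1≤lo
    outside (inj₂ ((_ , y≤) , _)) = ≤-trans y≤ top≤lo

lds-successorTable-only-1 : ∀ a ps {hi} → 1 < hi → hi ≤ a → lds 0 hi (successorTable a ps) ≡ 1
lds-successorTable-only-1 a [] 1<hi _ rewrite <ᵇ-true 1<hi = refl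
lds-successorTable-only-1 a (least ∷ ps) {hi} 1<hi hi≤a
  rewrite betweenᵇ-false 0 hi (extremalHead (suc a) ps)
            (inj₂ (≤-trans hi≤a (≤-trans (n≤1+n a) (proj₁ (extremalHead-bounded (suc a) ps)))))
  = lds-successorTable-only-1 (suc a) ps 1<hi (m≤n⇒m≤1+n hi≤a)
lds-successorTable-only-1 a (greatest ∷ ps) {hi} 1<hi hi≤a
  rewrite lds-∷ʳ 0 hi (successorTable a ps) (extremalHead a ps)
        | betweenᵇ-false 0 hi (extremalHead a ps) (inj₂ (≤-trans hi≤a (proj₁ (extremalHead-bounded a ps))))
  = lds-successorTable-only-1 a ps 1<hi hi≤a

lds-successorTable-under-top : ∀ {l H} a r → 2 ≤ a → a + suc (length r) < H →
  lds l (extremalHead a (greatest ∷ r)) (successorTable a (greatest ∷ r)) ≡ lds l H (successorTable a (greatest ∷ r))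
lds-successorTable-under-top {l} {H} a r 2≤a lt = lds-cong-hi l _ H (successorTable a (greatest ∷ r)) λ y∈ →
  trans (<ᵇ-true (below-top (All.lookup (successorTable-entries a (greatest ∷ r)) y∈)))
        (sym (<ᵇ-true (successorTable-< (≤-trans (s≤s z≤n) 2≤a) lt y∈)))
  where
  below-top : ∀ {y} → SuccessorEntry a (greatest ∷ r) y → y < suc (a + length r)
  below-top (inj₁ refl) = s≤s (≤-trans (s≤s z≤n) (≤-trans 2≤a (m≤m+n a _)))
  below-top {y} (inj₂ ((_ , y≤) , y≢top)) = ≤∧≢⇒< (subst (y ≤_) (+-suc a (length r)) y≤) y≢top

lds-successorTable-least-from-1 : ∀ {H} a r → 2 ≤ a →
  lds a H (successorTable a (least ∷ r)) ≡ lds 1 H (successorTable a (least ∷ r))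
lds-successorTable-least-from-1 {H} a r 2≤a = lds-cong-lo a 1 H (successorTable a (least ∷ r)) λ y∈ →
  same (All.lookup (successorTable-entries a (least ∷ r)) y∈)
  where
  same : ∀ {y} → SuccessorEntry a (least ∷ r) y → (a <ᵇ y) ≡ (1 <ᵇ y)
  same (inj₁ refl) = <ᵇ-false (≤-trans (s≤s z≤n) 2≤a)
  same {y} (inj₂ ((a≤y , _) , y≢a)) = trans (<ᵇ-true a<y) (sym (<ᵇ-true (≤-trans 2≤a (<⇒≤ a<y))))
    where
    a<y : a < y
    a<y = ≤∧≢⇒< a≤y (y≢a ∘ sym)

private
  module StepBounds (a : ℕ) (t : List Pick) {H : ℕ} (2≤a : 2 ≤ a) (lt : a + suc (length t) < H) where
    tail-least : suc a + length t < H
    tail-least = subst (_< H) (+-suc a (length t)) lt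
    tail-greatest : a + length t < H
    tail-greatest = ≤-<-trans (+-monoʳ-≤ a (n≤1+n _)) lt
    1<least-head : 1 < extremalHead (suc a) t
    1<least-head = ≤-trans (m≤n⇒m≤1+n 2≤a) (proj₁ (extremalHead-bounded (suc a) t))
    least-head<H : extremalHead (suc a) t < H
    least-head<H = ≤-<-trans (proj₂ (extremalHead-bounded (suc a) t)) tail-least
    1<greatest-last : 1 < extremalHead a t
    1<greatest-last = ≤-trans 2≤a (proj₁ (extremalHead-bounded a t))
    greatest-last<H : extremalHead a t < H
    greatest-last<H = ≤-<-trans (proj₂ (extremalHead-bounded a t)) tail-greatest

lds-successorTable-above-1 : ∀ a ps {H} → 2 ≤ a → a + length ps < H → lds 1 H (successorTable a ps) ≡ runs ps
lds-successorTable-above-1 a [] _ _ = refl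
lds-successorTable-above-1 a (least ∷ t) {H} 2≤a lt =
  trans (lds-∷-inside (successorTable (suc a) t) 1<least-head least-head<H)
        (below-head t tail-least (lds-successorTable-above-1 (suc a) t 2≤suc-a tail-least))
  where
  open StepBounds a t 2≤a lt
  2≤suc-a : 2 ≤ suc a
  2≤suc-a = m≤n⇒m≤1+n 2≤a
  below-head : ∀ t → suc a + length t < H → lds 1 H (successorTable (suc a) t) ≡ runs t →
    suc (lds 1 (extremalHead (suc a) t) (successorTable (suc a) t)) ⊔ lds 1 H (successorTable (suc a) t) ≡ runs (least ∷ t)
  below-head [] _ _ = refl
  below-head (least ∷ r) _ IH =
    cong₂ (λ x y → suc x ⊔ y) (lds-successorTable-below {suc a} {least ∷ r} ≤-refl ≤-refl) IH
  below-head (greatest ∷ r) lt′ IH =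
    trans (cong₂ (λ x y → suc x ⊔ y) (trans (lds-successorTable-under-top (suc a) r 2≤suc-a lt′) IH) IH)
          (m≥n⇒m⊔n≡m (n≤1+n _))
lds-successorTable-above-1 a (greatest ∷ t) {H} 2≤a lt =
  trans (lds-∷ʳ-inside (successorTable a t) 1<greatest-last greatest-last<H)
        (above-last t (lds-successorTable-above-1 a t 2≤a tail-greatest))
  where
  open StepBounds a t 2≤a lt
  1≤a : 1 ≤ a
  1≤a = ≤-trans (s≤s z≤n) 2≤a
  above-last : ∀ t → lds 1 H (successorTable a t) ≡ runs t →
    lds 1 H (successorTable a t) ⊔ suc (lds (extremalHead a t) H (successorTable a t)) ≡ runs (greatest ∷ t)
  above-last [] _ = cong (λ x → suc x) (lds-successorTable-above {a} {[]} {hi = H} 1≤a (≤-reflexive (+-identityʳ a)))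
  above-last (greatest ∷ r) IH =
    trans (cong₂ (λ x y → x ⊔ suc y) IH
                 (lds-successorTable-above {a} {greatest ∷ r} {hi = H} (s≤s z≤n) (≤-reflexive (+-suc a _))))
          (cong suc (⊔-identityʳ _))
  above-last (least ∷ r) IH =
    trans (cong₂ (λ x y → x ⊔ suc y) IH (trans (lds-successorTable-least-from-1 a r 2≤a) IH))
          (m≤n⇒m⊔n≡n (n≤1+n _))

private
  changes-least+allLeast-positive : ∀ r → 1 ≤ changes least r + allLeast r
  changes-least+allLeast-positive [] = ≤-refl
  changes-least+allLeast-positive (least ∷ r) = changes-least+allLeast-positive r
  changes-least+allLeast-positive (greatest ∷ r) = s≤s z≤n

  allLeast≤1 : ∀ r → allLeast r ≤ 1
  allLeast≤1 [] = ≤-refl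
  allLeast≤1 (least ∷ r) = allLeast≤1 r
  allLeast≤1 (greatest ∷ r) = z≤n

lds-successorTable : ∀ a ps {H} → 2 ≤ a → a + length ps < H → lds 0 H (successorTable a ps) ≡ runs ps + allLeast ps
lds-successorTable a [] 2≤a lt rewrite <ᵇ-true (≤-<-trans (≤-trans (s≤s z≤n) (≤-trans 2≤a (m≤m+n a 0))) lt) = refl
lds-successorTable a (least ∷ t) {H} 2≤a lt =
  trans (lds-∷-inside (successorTable (suc a) t) (<⇒≤ 1<least-head) least-head<H)
        (below-head t tail-least (lds-successorTable (suc a) t 2≤suc-a tail-least))
  where
  open StepBounds a t 2≤a lt
  2≤suc-a : 2 ≤ suc a
  2≤suc-a = m≤n⇒m≤1+n 2≤a
  only-1 : ∀ t → lds 0 (suc a) (successorTable (suc a) t) ≡ 1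
  only-1 t = lds-successorTable-only-1 (suc a) t 2≤suc-a ≤-refl
  below-head : ∀ t → suc a + length t < H → lds 0 H (successorTable (suc a) t) ≡ runs t + allLeast t →
    suc (lds 0 (extremalHead (suc a) t) (successorTable (suc a) t)) ⊔ lds 0 H (successorTable (suc a) t)
      ≡ runs (least ∷ t) + allLeast (least ∷ t)
  below-head [] _ IH = cong₂ (λ x y → suc x ⊔ y) (only-1 []) IH
  below-head (least ∷ r) _ IH =
    trans (cong₂ (λ x y → suc x ⊔ y) (only-1 (least ∷ r)) IH) (m≤n⇒m⊔n≡n (s≤s (changes-least+allLeast-positive r)))
  below-head (greatest ∷ r) lt′ IH =
    trans (cong₂ (λ x y → suc x ⊔ y) (trans (lds-successorTable-under-top (suc a) r 2≤suc-a lt′) IH) IH)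
          (m≥n⇒m⊔n≡m (n≤1+n _))
lds-successorTable a (greatest ∷ t) {H} 2≤a lt =
  trans (lds-∷ʳ-inside (successorTable a t) (<⇒≤ 1<greatest-last) greatest-last<H)
        (above-last t tail-greatest (lds-successorTable a t 2≤a tail-greatest))
  where
  open StepBounds a t 2≤a lt
  1≤a : 1 ≤ a
  1≤a = ≤-trans (s≤s z≤n) 2≤a
  above-last : ∀ t → a + length t < H → lds 0 H (successorTable a t) ≡ runs t + allLeast t →
    lds 0 H (successorTable a t) ⊔ suc (lds (extremalHead a t) H (successorTable a t)) ≡ runs (greatest ∷ t) + 0
  above-last [] _ IH = cong₂ (λ x y → x ⊔ suc y) IH (lds-successorTable-above {a} {[]} {hi = H} 1≤a (≤-reflexive (+-identityʳ a)))
  above-last (greatest ∷ r) _ IH =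
    trans (cong₂ (λ x y → x ⊔ suc y) IH
                 (lds-successorTable-above {a} {greatest ∷ r} {hi = H} (s≤s z≤n) (≤-reflexive (+-suc a _))))
          (m≥n⇒m⊔n≡m (s≤s z≤n))
  above-last (least ∷ r) lt′ IH =
    trans (cong₂ (λ x y → x ⊔ suc y) IH
                 (trans (lds-successorTable-least-from-1 a r 2≤a) (lds-successorTable-above-1 a (least ∷ r) 2≤a lt′)))
          (trans (m≤n⇒m⊔n≡n (s≤s (≤-trans (+-monoʳ-≤ (changes least r) (allLeast≤1 r)) (≤-reflexive (+-comm _ 1)))))
                 (sym (+-identityʳ _)))

Unique-cycleForm-cyclicPerm : ∀ ps → Unique (cycleForm (cyclicPerm ps))
Unique-cycleForm-cyclicPerm ps = subst Unique (sym (cycleForm-cyclicPerm ps))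
  (All.map (λ (2≤v , _) → <⇒≢ 2≤v) (extremal-bounded 2 ps) ∷ Unique-extremal 2 ps)

lds-cyclicPerm : ∀ ps → lds 0 (4 + length ps) (cyclicPerm (greatest ∷ ps)) ≡ 2 + changes greatest ps
lds-cyclicPerm ps = begin
  lds 0 H (3 + m ∷ P)                ≡⟨ lds-∷-inside P (s≤s z≤n) ≤-refl ⟩
  suc (lds 0 (3 + m) P) ⊔ lds 0 H P  ≡⟨ cong (λ x → suc x ⊔ lds 0 H P) (lds-successorTable-under-top 2 ps ≤-refl ≤-refl) ⟩
  suc (lds 0 H P) ⊔ lds 0 H P        ≡⟨ m≥n⇒m⊔n≡m (n≤1+n _) ⟩
  suc (lds 0 H P)                    ≡⟨ cong suc (trans (lds-successorTable 2 (greatest ∷ ps) ≤-refl ≤-refl) (+-identityʳ _)) ⟩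
  2 + changes greatest ps            ∎
  where
  open ≡-Reasoning
  m : ℕ
  m = length ps
  H : ℕ
  H = 4 + m
  P : List ℕ
  P = successorTable 2 (greatest ∷ ps)

goodᵇ-cyclicPerm : ∀ k ps → goodᵇ (3 + length ps) k (cyclicPerm (greatest ∷ ps)) ≡ (2 + changes greatest ps <ᵇ k)
goodᵇ-cyclicPerm k ps =
  trans (cong₂ _∧_ cyclic (cong₂ _∧_ (Equivalence.to T-≡ (≡⇒≡ᵇ (3 + m) (3 + m) refl)) (cong₂ _∧_ avoids rotations-avoid)))
        (∧-identityʳ _)
  where
  m : ℕ
  m = length ps
  π : List ℕ
  π = cyclicPerm (greatest ∷ ps)
  P : IsPermutation (3 + m) π
  P = cyclicPerm-isPermutation (greatest ∷ ps)
  cyclic : isCyclicᵇ π ≡ true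
  cyclic = Equivalence.to T-≡ (Unique⇒distinctᵇ (Unique-cycleForm-cyclicPerm (greatest ∷ ps)))
  avoids : avoidsᵇ (δ k) π ≡ (2 + changes greatest ps <ᵇ k)
  avoids = trans (avoidsᵇ-δ k π (4 + m) (All.map proj₁ (proj₁ (proj₂ P))) (All.map (s≤s ∘ proj₂) (proj₁ (proj₂ P))))
                 (cong (_<ᵇ k) (lds-cyclicPerm ps))
  rotations-avoid : allᵇ (avoidsᵇ p1342) (rotations (cycleForm π)) ≡ true
  rotations-avoid = Equivalence.to T-≡ (subst RotationsAvoid1342 (sym (cycleForm-cyclicPerm (greatest ∷ ps)))
    (Avoids213-231⇒rotations-avoid (extremal 2 ps) (extremal-bounded 2 ps) (extremal-avoids 2 ps)))

goodᵇ⁻ : ∀ n k π → T (goodᵇ n k π) →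
         Unique (cycleForm π) × T (firstIsᵇ n π) × RotationsAvoid1342 (cycleForm π)
goodᵇ⁻ n k π good =
  let cyclic , good′ = Equivalence.to (T-∧ {isCyclicᵇ π}) good
      first , good″ = Equivalence.to (T-∧ {firstIsᵇ n π}) good′
  in distinctᵇ⇒Unique _ cyclic , first , proj₂ (Equivalence.to (T-∧ {avoidsᵇ (δ k) π}) good″)

cycleForm-extremal : ∀ m {x π′} → IsPermutation (3 + m) (x ∷ π′) → x ≡ 3 + m → Unique (cycleForm (x ∷ π′)) →
                     RotationsAvoid1342 (cycleForm (x ∷ π′)) →
                     ∃ λ ps → length ps ≡ m × cycleForm (x ∷ π′) ≡ 1 ∷ 3 + m ∷ extremal 2 ps
cycleForm-extremal m {x} {π′} P@(|π| , π⊆ , _) refl unique rotations-avoid =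
  let ps , |ps| , w≡ = extremal-complete m 2 unique-w (length-orbit (x ∷ π′) (suc m) (app (x ∷ π′) x)) w-inner
                         (rotations-avoid⇒Avoids213-231 w w-inner (subst RotationsAvoid1342 cf≡ rotations-avoid))
  in ps , |ps| , trans cf≡ (cong (λ v → 1 ∷ x ∷ v) w≡)
  where
  w : List ℕ
  w = orbit (x ∷ π′) (suc m) (app (x ∷ π′) x)
  cf≡ : cycleForm (x ∷ π′) ≡ 1 ∷ x ∷ w
  cf≡ = cong (λ l → orbit (x ∷ π′) l 1) |π|
  unique′ : Unique (1 ∷ x ∷ w)
  unique′ = subst Unique cf≡ unique
  unique-w : Unique w
  unique-w with unique′
  ... | _ ∷ _ ∷ u = u
  w-inner : All (_∈[ 2 ⋯ 2 + m ]) w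
  w-inner with unique′ | orbit-bounded P (2 + m) (All.lookup π⊆ (here refl))
  ... | 1∉ ∷ x∉ ∷ _ | _ ∷ w⊆ = All.zipWith inner (All.tail 1∉ , All.zipWith (λ (x≢v , v∈) → x≢v , v∈) (x∉ , w⊆))
    where
    inner : ∀ {v} → 1 ≢ v × x ≢ v × v ∈[ 1 ⋯ 3 + m ] → v ∈[ 2 ⋯ 2 + m ]
    inner (1≢v , x≢v , 1≤v , v≤x) = ≤∧≢⇒< 1≤v 1≢v , ≤-pred (≤∧≢⇒< v≤x (x≢v ∘ sym))

goodᵇ⇒cyclicPerm : ∀ m k {π} → IsPermutation (3 + m) π → T (goodᵇ (3 + m) k π) →
                   ∃ λ ps → length ps ≡ m × π ≡ cyclicPerm (greatest ∷ ps)
goodᵇ⇒cyclicPerm m k {x ∷ π′} P good with goodᵇ⁻ (3 + m) k (x ∷ π′) good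
... | unique , first , rotations-avoid
  with ps , refl , cf≡ ← cycleForm-extremal m P (≡ᵇ⇒≡ x (3 + m) first) unique rotations-avoid =
  ps , refl , cycleForm-injective P (cyclicPerm-isPermutation (greatest ∷ ps)) unique
                (trans cf≡ (sym (cycleForm-cyclicPerm (greatest ∷ ps))))

cyclicPerm-injective : ∀ {ps qs} → cyclicPerm ps ≡ cyclicPerm qs → ps ≡ qs
cyclicPerm-injective {ps} {qs} eq =
  extremal-injective 2 (∷-injectiveʳ (trans (sym (cycleForm-cyclicPerm ps)) (trans (cong cycleForm eq) (cycleForm-cyclicPerm qs))))

allPicks : ℕ → List (List Pick)
allPicks zero = [ [] ]
allPicks (suc m) = map (least ∷_) (allPicks m) ++ map (greatest ∷_) (allPicks m)

∈-allPicks⁻ : ∀ m {ps} → ps ∈ allPicks m → length ps ≡ m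
∈-allPicks⁻ zero (here refl) = refl
∈-allPicks⁻ (suc m) ps∈ with ∈-++⁻ (map (least ∷_) (allPicks m)) ps∈
... | inj₁ ps∈ˡ with _ , qs∈ , refl ← ∈-map⁻ (least ∷_) ps∈ˡ = cong suc (∈-allPicks⁻ m qs∈)
... | inj₂ ps∈ʳ with _ , qs∈ , refl ← ∈-map⁻ (greatest ∷_) ps∈ʳ = cong suc (∈-allPicks⁻ m qs∈)

∈-allPicks⁺ : ∀ ps → ps ∈ allPicks (length ps)
∈-allPicks⁺ [] = here refl
∈-allPicks⁺ (least ∷ ps) = ∈-++⁺ˡ (∈-map⁺ (least ∷_) (∈-allPicks⁺ ps))
∈-allPicks⁺ (greatest ∷ ps) = ∈-++⁺ʳ (map (least ∷_) (allPicks (length ps))) (∈-map⁺ (greatest ∷_) (∈-allPicks⁺ ps))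

Unique-allPicks : ∀ m → Unique (allPicks m)
Unique-allPicks zero = [] ∷ []
Unique-allPicks (suc m) =
  Unique.++⁺ (Unique.map⁺ ∷-injectiveʳ (Unique-allPicks m)) (Unique.map⁺ ∷-injectiveʳ (Unique-allPicks m)) disjoint
  where
  disjoint : ∀ {ps} → ¬ (ps ∈ map (least ∷_) (allPicks m) × ps ∈ map (greatest ∷_) (allPicks m))
  disjoint (ps∈ˡ , ps∈ʳ) with ∈-map⁻ (least ∷_) ps∈ˡ | ∈-map⁻ (greatest ∷_) ps∈ʳ
  ... | _ , _ , refl | _ , _ , ()

b°-count : ∀ m k → b° (3 + m) k ≡ length (filter (λ ps → T? (2 + changes greatest ps <ᵇ k)) (allPicks m))
b°-count m k = begin
  b° N k                                         ≡⟨ cong length (filterᵇ≡filter (goodᵇ N k) (perms N)) ⟩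
  length (filter (T? ∘ goodᵇ N k) (perms N))     ≡⟨ Unique-length-≡ unique-good unique-image good⇒image image⇒good ⟩
  length (map permOf (filter counted (allPicks m))) ≡⟨ length-map permOf (filter counted (allPicks m)) ⟩
  length (filter counted (allPicks m))           ∎
  where
  open ≡-Reasoning
  N : ℕ
  N = 3 + m
  permOf : List Pick → List ℕ
  permOf ps = cyclicPerm (greatest ∷ ps)
  counted : ∀ ps → Dec (T (2 + changes greatest ps <ᵇ k))
  counted ps = T? (2 + changes greatest ps <ᵇ k)
  good-permOf : ∀ {ps} → length ps ≡ m → T (goodᵇ N k (permOf ps)) → T (2 + changes greatest ps <ᵇ k)
  good-permOf {ps} refl = subst T (goodᵇ-cyclicPerm k ps)
  unique-good : Unique (filter (T? ∘ goodᵇ N k) (perms N))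
  unique-good = Unique.filter⁺ (T? ∘ goodᵇ N k) (Unique-perms N)
  unique-image : Unique (map permOf (filter counted (allPicks m)))
  unique-image = Unique.map⁺ (∷-injectiveʳ ∘ cyclicPerm-injective) (Unique.filter⁺ counted (Unique-allPicks m))
  good⇒image : ∀ {π} → π ∈ filter (T? ∘ goodᵇ N k) (perms N) → π ∈ map permOf (filter counted (allPicks m))
  good⇒image π∈ with ∈-filter⁻ (T? ∘ goodᵇ N k) π∈
  ... | π∈perms , good with goodᵇ⇒cyclicPerm m k (∈-perms⁻ N π∈perms) good
  ...   | ps , refl , refl = ∈-map⁺ permOf (∈-filter⁺ counted (∈-allPicks⁺ ps) (good-permOf {ps} refl good))
  image⇒good : ∀ {π} → π ∈ map permOf (filter counted (allPicks m)) → π ∈ filter (T? ∘ goodᵇ N k) (perms N)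
  image⇒good π∈ with ∈-map⁻ permOf π∈
  ... | ps , ps∈ , refl with ∈-filter⁻ counted ps∈
  ...   | ps∈all , few-changes with ∈-allPicks⁻ m ps∈all
  ...     | refl = ∈-filter⁺ (T? ∘ goodᵇ N k) (∈-perms⁺ N (cyclicPerm-isPermutation (greatest ∷ ps)))
                              (subst T (sym (goodᵇ-cyclicPerm k ps)) few-changes)

-- Counting pick sequences by their number of changes

fewerChanges : Pick → ℕ → ℕ → ℕ
fewerChanges p m j = length (filter (T? ∘ λ ps → changes p ps <ᵇ j) (allPicks m))

b°≡fewerChanges : ∀ m j → b° (3 + m) (2 + j) ≡ fewerChanges greatest m j
b°≡fewerChanges m j = b°-count m (2 + j)

private
  filter-map : ∀ {B : Set} (P : B → Bool) (f : A → B) xs → filter (T? ∘ P) (map f xs) ≡ map f (filter (T? ∘ P ∘ f) xs)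
  filter-map P f [] = refl
  filter-map P f (x ∷ xs) with P (f x)
  ... | true = cong (f x ∷_) (filter-map P f xs)
  ... | false = filter-map P f xs

  length-filter-allPicks : ∀ (P : List Pick → Bool) m → length (filter (T? ∘ P) (allPicks (suc m)))
    ≡ length (filter (T? ∘ P ∘ (least ∷_)) (allPicks m)) + length (filter (T? ∘ P ∘ (greatest ∷_)) (allPicks m))
  length-filter-allPicks P m = begin
    length (filter (T? ∘ P) (map (least ∷_) L ++ map (greatest ∷_) L))
      ≡⟨ cong length (filter-++ (T? ∘ P) (map (least ∷_) L) (map (greatest ∷_) L)) ⟩
    length (filter (T? ∘ P) (map (least ∷_) L) ++ filter (T? ∘ P) (map (greatest ∷_) L))
      ≡⟨ length-++ (filter (T? ∘ P) (map (least ∷_) L)) ⟩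
    length (filter (T? ∘ P) (map (least ∷_) L)) + length (filter (T? ∘ P) (map (greatest ∷_) L))
      ≡⟨ cong₂ _+_ (prefixed least) (prefixed greatest) ⟩
    length (filter (T? ∘ P ∘ (least ∷_)) L) + length (filter (T? ∘ P ∘ (greatest ∷_)) L)
      ∎
    where
    open ≡-Reasoning
    L : List (List Pick)
    L = allPicks m
    prefixed : ∀ p → length (filter (T? ∘ P) (map (p ∷_) L)) ≡ length (filter (T? ∘ P ∘ (p ∷_)) L)
    prefixed p = trans (cong length (filter-map P (p ∷_) L)) (length-map prepend (filter (T? ∘ P ∘ prepend) L))
      where
      prepend : List Pick → List Pick
      prepend = p ∷_

fewerChanges-zero : ∀ p m → fewerChanges p m 0 ≡ 0
fewerChanges-zero p m =
  cong length (filter-none {P = λ ps → T (changes p ps <ᵇ 0)} (T? ∘ λ ps → changes p ps <ᵇ 0) {allPicks m} (All.tabulate λ _ ()))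

fewerChanges-least : ∀ m j → fewerChanges least (suc m) (suc j) ≡ fewerChanges least m (suc j) + fewerChanges greatest m j
fewerChanges-least m j = length-filter-allPicks (λ ps → changes least ps <ᵇ suc j) m

fewerChanges-greatest : ∀ m j → fewerChanges greatest (suc m) (suc j) ≡ fewerChanges least m j + fewerChanges greatest m (suc j)
fewerChanges-greatest m j = length-filter-allPicks (λ ps → changes greatest ps <ᵇ suc j) m

fewerChanges-symmetric : ∀ m j → fewerChanges least m j ≡ fewerChanges greatest m j
fewerChanges-symmetric zero zero = refl
fewerChanges-symmetric zero (suc j) = refl
fewerChanges-symmetric (suc m) zero = trans (fewerChanges-zero least (suc m)) (sym (fewerChanges-zero greatest (suc m)))
fewerChanges-symmetric (suc m) (suc j) = begin
  fewerChanges least (suc m) (suc j)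
    ≡⟨ fewerChanges-least m j ⟩
  fewerChanges least m (suc j) + fewerChanges greatest m j
    ≡⟨ cong₂ _+_ (fewerChanges-symmetric m (suc j)) (sym (fewerChanges-symmetric m j)) ⟩
  fewerChanges greatest m (suc j) + fewerChanges least m j
    ≡⟨ +-comm (fewerChanges greatest m (suc j)) _ ⟩
  fewerChanges least m j + fewerChanges greatest m (suc j)
    ≡⟨ sym (fewerChanges-greatest m j) ⟩
  fewerChanges greatest (suc m) (suc j)
    ∎
  where open ≡-Reasoning

fewerChanges-rec : ∀ m j → fewerChanges greatest (suc m) (suc j) ≡ fewerChanges greatest m j + fewerChanges greatest m (suc j)
fewerChanges-rec m j = trans (fewerChanges-greatest m j) (cong (_+ fewerChanges greatest m (suc j)) (fewerChanges-symmetric m j))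

fewerChanges-one : ∀ m → fewerChanges greatest m 1 ≡ 1
fewerChanges-one zero = refl
fewerChanges-one (suc m) = trans (fewerChanges-rec m 0) (cong₂ _+_ (fewerChanges-zero greatest m) (fewerChanges-one m))

open PowerSeries using (Bformula-rec; Bformula-3; Bformula-initial)

b°-3 : ∀ n → 1 ≤ n → b° n 3 ≡ 1
b°-3 1 _ = refl
b°-3 2 _ = refl
b°-3 (suc (suc (suc m))) _ = trans (b°≡fewerChanges m 1) (fewerChanges-one m)

b°-rec : ∀ m i → b° (4 + m) (4 + i) ≡ b° (3 + m) (4 + i) + b° (3 + m) (3 + i)
b°-rec m i = begin
  b° (4 + m) (4 + i)
    ≡⟨ b°≡fewerChanges (suc m) (2 + i) ⟩
  fewerChanges greatest (suc m) (2 + i)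
    ≡⟨ fewerChanges-rec m (suc i) ⟩
  fewerChanges greatest m (1 + i) + fewerChanges greatest m (2 + i)
    ≡⟨ +-comm (fewerChanges greatest m (1 + i)) _ ⟩
  fewerChanges greatest m (2 + i) + fewerChanges greatest m (1 + i)
    ≡⟨ sym (cong₂ _+_ (b°≡fewerChanges m (2 + i)) (b°≡fewerChanges m (1 + i))) ⟩
  b° (3 + m) (4 + i) + b° (3 + m) (3 + i)
    ∎
  where open ≡-Reasoning

B≡Bformula : ∀ m i → B (3 + i) m ≡ Bformula (3 + i) m
B≡Bformula 0 i = sym (Bformula-initial (3 + i) z≤n)
B≡Bformula 1 i = sym (Bformula-initial (3 + i) (s≤s z≤n))
B≡Bformula 2 i = sym (Bformula-initial (3 + i) (s≤s (s≤s z≤n)))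
B≡Bformula 3 i = trans (cong ℤ.+_ (b°≡fewerChanges 0 (suc i))) (sym (Bformula-initial (3 + i) (s≤s (s≤s (s≤s z≤n)))))
B≡Bformula (suc (suc (suc (suc j)))) zero = trans (cong ℤ.+_ (b°-3 (4 + j) (s≤s z≤n))) (sym (Bformula-3 j))
B≡Bformula (suc (suc (suc (suc j)))) (suc r) =
  trans (cong ℤ.+_ (b°-rec j r))
        (trans (ℤ.pos-+ (b° (3 + j) (4 + r)) (b° (3 + j) (3 + r)))
               (trans (cong₂ ℤ._+_ (B≡Bformula (suc (suc (suc j))) (suc r)) (B≡Bformula (suc (suc (suc j))) r))
                      (sym (Bformula-rec r j))))

lemma3p7 : ((n : ℕ) → 1 ≤ n → b° n 3 ≡ 1)
           × ((n k : ℕ) → 4 ≤ n → 4 ≤ k → b° n k ≡ b° (n ∸ 1) k + b° (n ∸ 1) (k ∸ 1))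
           × ((k : ℕ) → 3 ≤ k → (m : ℕ) → B k m ≡ Bformula k m)
lemma3p7 = b°-3 , b°-rec′ , B≡Bformula′
  where
  b°-rec′ : (n k : ℕ) → 4 ≤ n → 4 ≤ k → b° n k ≡ b° (n ∸ 1) k + b° (n ∸ 1) (k ∸ 1)
  b°-rec′ _ _ (s≤s (s≤s (s≤s (s≤s {n = m} _)))) (s≤s (s≤s (s≤s (s≤s {n = i} _)))) = b°-rec m i
  B≡Bformula′ : (k : ℕ) → 3 ≤ k → (m : ℕ) → B k m ≡ Bformula k m
  B≡Bformula′ _ (s≤s (s≤s (s≤s {n = i} _))) m = B≡Bformula m i
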